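{- Let $\ell$ be a prime with $\ell\equiv\pm1\pmod8$. Let $\nu$ be a positive integer all of whose prime factors are congruent to $\pm1\pmod 8$, and with $\nu\equiv 0,\pm3,\pm4\pmod9$. Let $k=4+2\nu^2$. Then $k$ is a Hasse failure for the Markoff surface over $\mathbb Z[1/\ell]$: for every positive integer $q$ the congruence $x_1^2+x_2^2+x_3^2-x_1x_2x_3\equiv k$ has a solution in $(\mathbb Z[1/\ell]/q\mathbb Z[1/\ell])^3$, but the equation $x_1^2+x_2^2+x_3^2-x_1x_2x_3=k$ has no solution with $x_1,x_2,x_3\in\mathbb Z[1/\ell]$. -}

module Defs where

open import Data.Nat as ℕ using (ℕ; _^_; _%_)
open import Data.Integer as ℤ using (ℤ)
open import Data.Rational using (ℚ; _/_; _+_; _-_; _*_)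
open import Data.Product using (∃; ∃-syntax; _×_)
open import Data.Sum using (_⊎_)
open import Relation.Binary.PropositionalEquality using (_≡_)

ιℤ : ℤ → ℚ
ιℤ z = z / 1

ιℕ : ℕ → ℚ
ιℕ n = ιℤ (ℤ.+ n)

InZ[1/_] : ℕ → ℚ → Set
InZ[1/ ℓ ] x = ∃[ e ] ∃[ a ] ιℕ (ℓ ^ e) * x ≡ ιℤ a

markoff : ℚ → ℚ → ℚ → ℚ
markoff x₁ x₂ x₃ = x₁ * x₁ + x₂ * x₂ + x₃ * x₃ - x₁ * x₂ * x₃

-- x ≡ y in ℤ[1/ℓ] / q ℤ[1/ℓ]  (for x, y ∈ ℤ[1/ℓ]):  x − y ∈ q ℤ[1/ℓ]
CongMod : (ℓ q : ℕ) → ℚ → ℚ → Set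
CongMod ℓ q x y = ∃[ z ] (InZ[1/ ℓ ] z × x - y ≡ ιℕ q * z)

PlusMinusOneMod8 : ℕ → Set
PlusMinusOneMod8 n = n % 8 ≡ 1 ⊎ n % 8 ≡ 7

{-# OPTIONS --safe #-}
module Submission where

-- Modulo powers of 2 and of 3, Hensel's lemma lifts a nonsingular
-- solution modulo 2, resp. 3; when ν ≡ ±4 (mod 9) all solutions modulo 3 are singular, but
-- then 9 ∣ k and one lifts solutions of the equation obtained by scaling the coordinates by 3.
-- Modulo integers prime to 6 the rational point (45, 36 − 16ν², 45 − 32ν²)/18 reduces to a
-- solution, and the Chinese remainder theorem glues the pieces together.
--
-- Clearing denominators gives d = ℓᵉ and integers b₁, b₂, b₃ with
-- d(b₁² + b₂² + b₃²) − b₁b₂b₃ = k d³. Parity excludes that all bᵢ are even, so say b₁ is odd;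
-- then N = b₁² − 4d² ≡ 5 (mod 8). A prime p ∣ N either divides νd, and then p ≡ ±1 (mod 8) by
-- hypothesis, or divides b₁ ∓ 2d, and then the equation gives p ∣ (b₂ ∓ b₃)² − 2(νd)², so 2 is
-- a square modulo p and again p ≡ ±1 (mod 8). Hence N ≡ ±1 (mod 8), a contradiction.

module Divisibility where
  open import Data.Nat as ℕ using (ℕ; zero; suc)
  import Data.Nat.Divisibility as ℕ
  open import Data.Nat.Coprimality using (Coprime; coprime-Bézout)
  open import Data.Nat.GCD using (module Bézout)
  open import Data.Nat.Primality using (Prime; euclidsLemma; prime⇒irreducible)
  open import Data.Integer as ℤ using (ℤ; +_; _+_; _*_; -_; 0ℤ; 1ℤ)
  import Data.Integer.Properties as ℤ
  open import Data.Integer.Divisibility.Signed using (_∣_; ∣⇒∣ᵤ; ∣ᵤ⇒∣)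
  open import Data.Integer.Tactic.RingSolver using (solve-∀)
  open import Data.Product using (∃-syntax; _,_)
  open import Data.Sum as Sum using (_⊎_; inj₁; inj₂)
  open import Data.Empty using (⊥-elim)
  open import Relation.Nullary using (¬_)
  open import Relation.Binary.PropositionalEquality

  prime∣*⇒∣⊎∣ : ∀ {p} a b → Prime p → + p ∣ a * b → + p ∣ a ⊎ + p ∣ b
  prime∣*⇒∣⊎∣ {p} a b p-prime p∣ab = Sum.map ∣ᵤ⇒∣ ∣ᵤ⇒∣
    (euclidsLemma ℤ.∣ a ∣ ℤ.∣ b ∣ p-prime (subst (p ℕ.∣_) (ℤ.abs-* a b) (∣⇒∣ᵤ p∣ab)))

  prime∣*-cancelˡ : ∀ {p} a b → Prime p → ¬ + p ∣ a → + p ∣ a * b → + p ∣ b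
  prime∣*-cancelˡ a b p-prime p∤a p∣ab with prime∣*⇒∣⊎∣ a b p-prime p∣ab
  ... | inj₁ p∣a = ⊥-elim (p∤a p∣a)
  ... | inj₂ p∣b = p∣b

  Unimodular : ℤ → ℤ → Set
  Unimodular m n = ∃[ u ] ∃[ v ] u * m + v * n ≡ 1ℤ

  private
    bézout-identity : ∀ {x m y n} → 1 ℕ.+ y ℕ.* n ≡ x ℕ.* m → + x * + m + - + y * + n ≡ 1ℤ
    bézout-identity {x} {m} {y} {n} eq = begin
      + x * + m + - + y * + n          ≡⟨ cong (_+ - + y * + n) (ℤ.pos-* x m) ⟨
      + (x ℕ.* m) + - + y * + n        ≡⟨ cong (λ t → + t + - + y * + n) eq ⟨
      + (1 ℕ.+ y ℕ.* n) + - + y * + n  ≡⟨ cong (λ t → 1ℤ + t + - + y * + n) (ℤ.pos-* y n) ⟩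
      1ℤ + + y * + n + - + y * + n     ≡⟨ cancel (+ y) (+ n) ⟩
      1ℤ                               ∎
      where
      open ≡-Reasoning
      cancel : ∀ a b → 1ℤ + a * b + - a * b ≡ 1ℤ
      cancel = solve-∀

  coprime⇒unimodular : ∀ {m n} → Coprime m n → Unimodular (+ m) (+ n)
  coprime⇒unimodular {m} {n} coprime with coprime-Bézout coprime
  ... | Bézout.+- x y eq = + x , - + y , bézout-identity {x} {m} {y} {n} eq
  ... | Bézout.-+ x y eq = - + x , + y , trans (ℤ.+-comm (- + x * + m) (+ y * + n)) (bézout-identity {y} {n} {x} {m} eq)

  prime⇒unimodular : ∀ {p n} → Prime p → ¬ p ℕ.∣ n → Unimodular (+ p) (+ n)
  prime⇒unimodular {p} {n} p-prime p∤n = coprime⇒unimodular coprime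
    where
    coprime : Coprime p n
    coprime (i∣p , i∣n) with prime⇒irreducible p-prime i∣p
    ... | inj₁ i≡1 = i≡1
    ... | inj₂ refl = ⊥-elim (p∤n i∣n)

  unimodular-*ˡ : ∀ {m₁ m₂ n} → Unimodular m₁ n → Unimodular m₂ n → Unimodular (m₁ * m₂) n
  unimodular-*ˡ {m₁} {m₂} {n} (u₁ , v₁ , eq₁) (u₂ , v₂ , eq₂) =
    u₁ * u₂ , u₁ * m₁ * v₂ + v₁ * (u₂ * m₂ + v₂ * n) , (begin
      u₁ * u₂ * (m₁ * m₂) + (u₁ * m₁ * v₂ + v₁ * (u₂ * m₂ + v₂ * n)) * n
        ≡⟨ expand u₁ v₁ u₂ v₂ m₁ m₂ n ⟩
      (u₁ * m₁ + v₁ * n) * (u₂ * m₂ + v₂ * n)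
        ≡⟨ cong₂ _*_ eq₁ eq₂ ⟩
      1ℤ ∎)
    where
    open ≡-Reasoning
    expand : ∀ u₁ v₁ u₂ v₂ m₁ m₂ n →
      u₁ * u₂ * (m₁ * m₂) + (u₁ * m₁ * v₂ + v₁ * (u₂ * m₂ + v₂ * n)) * n
        ≡ (u₁ * m₁ + v₁ * n) * (u₂ * m₂ + v₂ * n)
    expand = solve-∀

  unimodular-^ˡ : ∀ {m n} → Unimodular (+ m) n → ∀ a → Unimodular (+ (m ℕ.^ a)) n
  unimodular-^ˡ {n = n} _ zero = 1ℤ , 0ℤ , ℤ.+-identityʳ 1ℤ
  unimodular-^ˡ {m} unimodular (suc a) = subst (λ d → Unimodular d _) (sym (ℤ.pos-* m (m ℕ.^ a)))
    (unimodular-*ˡ unimodular (unimodular-^ˡ unimodular a))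

module LocalSolutions where
  open Divisibility
  open import Data.Nat as ℕ using (ℕ; zero; suc; s≤s)
  import Data.Nat.Properties as ℕ
  import Data.Nat.Divisibility as ℕ
  import Data.Nat.DivMod as ℕ
  open import Data.Nat.Induction using (<-wellFounded)
  open import Data.Nat.Tactic.RingSolver using () renaming (solve-∀ to ℕ-solve-∀)
  open import Data.Nat.Primality using (Prime; prime[2]; prime?)
  open import Induction.WellFounded using (Acc; acc)
  open import Relation.Nullary using (¬_; yes; no)
  open import Relation.Nullary.Decidable using (from-yes)
  open import Data.Integer as ℤ using (ℤ; +_; _+_; _*_; _-_; -_; 0ℤ; 1ℤ)
  import Data.Integer.Properties as ℤ
  open import Data.Integer.DivMod using (_%ℕ_; _/ℕ_; n%ℕd<d; a≡a%ℕn+[a/ℕn]*n)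
  open import Data.Integer.Divisibility.Signed
    using (_∣_; divides; ∣ᵤ⇒∣; ∣-refl; ∣-trans; ∣m∣n⇒∣m+n; ∣m∣n⇒∣m-n; ∣m⇒∣-m; ∣m⇒∣m*n; ∣n⇒∣m*n)
  open import Data.Integer.Tactic.RingSolver using (solve-∀)
  open import Data.Product using (∃-syntax; _×_; _,_)
  open import Data.Sum using (_⊎_; inj₁; inj₂)
  open import Relation.Binary.PropositionalEquality

  markoffℤ : ℤ → ℤ → ℤ → ℤ
  markoffℤ x₁ x₂ x₃ = x₁ * x₁ + x₂ * x₂ + x₃ * x₃ - x₁ * x₂ * x₃

  SolvableMod : ℤ → ℕ → Set
  SolvableMod k m = ∃[ x₁ ] ∃[ x₂ ] ∃[ x₃ ] + m ∣ markoffℤ x₁ x₂ x₃ - k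

  solvableMod-1 : ∀ k → SolvableMod k 1
  solvableMod-1 k = 0ℤ , 0ℤ , 0ℤ , ∣ᵤ⇒∣ (ℕ.1∣ _)

  ∣-respʳ : ∀ {m a b} → a ≡ b → m ∣ a → m ∣ b
  ∣-respʳ refl m∣a = m∣a

  *-pres-∣ : ∀ {a b c d} → a ∣ b → c ∣ d → a * c ∣ b * d
  *-pres-∣ {a} {c = c} (divides s refl) (divides t refl) = divides (s * t) (lemma s a t c)
    where lemma : ∀ s a t c → s * a * (t * c) ≡ s * t * (a * c)
          lemma = solve-∀

  ∣-sub-trans : ∀ {m} x y z → m ∣ x - y → m ∣ y - z → m ∣ x - z
  ∣-sub-trans x y z m∣x-y m∣y-z = ∣-respʳ (lemma x y z) (∣m∣n⇒∣m+n m∣x-y m∣y-z)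
    where lemma : ∀ x y z → x - y + (y - z) ≡ x - z
          lemma = solve-∀

  markoff-cong : ∀ {m} x₁ x₂ x₃ a₁ a₂ a₃ → m ∣ x₁ - a₁ → m ∣ x₂ - a₂ → m ∣ x₃ - a₃
               → m ∣ markoffℤ x₁ x₂ x₃ - markoffℤ a₁ a₂ a₃
  markoff-cong x₁ x₂ x₃ a₁ a₂ a₃ m∣₁ m∣₂ m∣₃ = ∣-respʳ (sym (difference x₁ x₂ x₃ a₁ a₂ a₃))
    (∣m∣n⇒∣m-n
      (∣m∣n⇒∣m+n (∣m∣n⇒∣m+n (∣m⇒∣m*n (x₁ + a₁) m∣₁) (∣m⇒∣m*n (x₂ + a₂) m∣₂)) (∣m⇒∣m*n (x₃ + a₃) m∣₃))
      (∣m∣n⇒∣m+n (∣m∣n⇒∣m+n (∣m⇒∣m*n (x₂ * x₃) m∣₁) (∣m⇒∣m*n (a₁ * x₃) m∣₂)) (∣m⇒∣m*n (a₁ * a₂) m∣₃)))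
    where
    difference : ∀ x₁ x₂ x₃ a₁ a₂ a₃ →
      (x₁ * x₁ + x₂ * x₂ + x₃ * x₃ - x₁ * x₂ * x₃) - (a₁ * a₁ + a₂ * a₂ + a₃ * a₃ - a₁ * a₂ * a₃)
        ≡ (x₁ - a₁) * (x₁ + a₁) + (x₂ - a₂) * (x₂ + a₂) + (x₃ - a₃) * (x₃ + a₃)
          - ((x₁ - a₁) * (x₂ * x₃) + (x₂ - a₂) * (a₁ * x₃) + (x₃ - a₃) * (a₁ * a₂))
    difference = solve-∀

  unimodular⇒∣* : ∀ {m n z} → Unimodular m n → m ∣ z → n ∣ z → m * n ∣ z
  unimodular⇒∣* {m} {n} {z} (u , v , eq) (divides r refl) (divides s z≡sn) = divides (u * s + v * r) (begin
    r * m                        ≡⟨ ℤ.*-identityʳ (r * m) ⟨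
    r * m * 1ℤ                   ≡⟨ cong (r * m *_) eq ⟨
    r * m * (u * m + v * n)      ≡⟨ expand r m u v n ⟩
    u * m * (r * m) + v * r * (m * n)  ≡⟨ cong (λ t → u * m * t + v * r * (m * n)) z≡sn ⟩
    u * m * (s * n) + v * r * (m * n)  ≡⟨ collect u m s n v r ⟩
    (u * s + v * r) * (m * n)    ∎)
    where
    open ≡-Reasoning
    expand : ∀ r m u v n → r * m * (u * m + v * n) ≡ u * m * (r * m) + v * r * (m * n)
    expand = solve-∀
    collect : ∀ u m s n v r → u * m * (s * n) + v * r * (m * n) ≡ (u * s + v * r) * (m * n)
    collect = solve-∀

  private
    interpolate : ∀ a b u v m n → u * m + v * n ≡ 1ℤ → a * (v * n) + b * (u * m) - a ≡ (b - a) * u * m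
    interpolate a b u v m n eq = begin
      a * (v * n) + b * (u * m) - a                ≡⟨ expand a b u v m n ⟩
      a * (u * m + v * n) - a + (b - a) * u * m    ≡⟨ cong (λ t → a * t - a + (b - a) * u * m) eq ⟩
      a * 1ℤ - a + (b - a) * u * m                 ≡⟨ simplify a b u m ⟩
      (b - a) * u * m                              ∎
      where
      open ≡-Reasoning
      expand : ∀ a b u v m n → a * (v * n) + b * (u * m) - a ≡ a * (u * m + v * n) - a + (b - a) * u * m
      expand = solve-∀
      simplify : ∀ a b u m → a * 1ℤ - a + (b - a) * u * m ≡ (b - a) * u * m
      simplify = solve-∀

  solvableMod-* : ∀ {k m n} → Unimodular (+ m) (+ n) → SolvableMod k m → SolvableMod k n → SolvableMod k (m ℕ.* n)
  solvableMod-* {k} {m} {n} (u , v , eq) (a₁ , a₂ , a₃ , m∣a) (b₁ , b₂ , b₃ , n∣b) =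
    x₁ , x₂ , x₃ ,
    subst (_∣ x - k) (sym (ℤ.pos-* m n))
      (unimodular⇒∣* (u , v , eq)
        (∣-sub-trans x (markoffℤ a₁ a₂ a₃) k
          (markoff-cong x₁ x₂ x₃ a₁ a₂ a₃ (glue≡ˡ a₁ b₁) (glue≡ˡ a₂ b₂) (glue≡ˡ a₃ b₃)) m∣a)
        (∣-sub-trans x (markoffℤ b₁ b₂ b₃) k
          (markoff-cong x₁ x₂ x₃ b₁ b₂ b₃ (glue≡ʳ a₁ b₁) (glue≡ʳ a₂ b₂) (glue≡ʳ a₃ b₃)) n∣b))
    where
    glue : ℤ → ℤ → ℤ
    glue a b = a * (v * + n) + b * (u * + m)
    x₁ x₂ x₃ x : ℤ
    x₁ = glue a₁ b₁
    x₂ = glue a₂ b₂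
    x₃ = glue a₃ b₃
    x = markoffℤ x₁ x₂ x₃
    glue≡ˡ : ∀ a b → + m ∣ glue a b - a
    glue≡ˡ a b = divides ((b - a) * u) (interpolate a b u v (+ m) (+ n) eq)
    glue≡ʳ : ∀ a b → + n ∣ glue a b - b
    glue≡ʳ a b = divides ((a - b) * v)
      (trans (cong (_- b) (ℤ.+-comm (a * (v * + n)) (b * (u * + m))))
             (interpolate b a v u (+ n) (+ m) (trans (ℤ.+-comm (v * + n) (u * + m)) eq)))

  quadratic : ℤ → ℤ → ℤ → ℤ
  quadratic c e y = y * y - c * y + e

  -- Newton's iteration z ↦ z − f(z)·w, with w a fixed inverse of f′(y) modulo M.
  hensel : ∀ M c e y w → + M ∣ quadratic c e y → + M ∣ w * (+ 2 * y - c) - 1ℤ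
         → ∀ n → ∃[ z ] (+ (M ℕ.^ suc n) ∣ quadratic c e z × + M ∣ z - y)
  hensel M c e y w M∣f M∣f′ zero =
    y , subst (_∣ quadratic c e y) (cong +_ (sym (ℕ.*-identityʳ M))) M∣f , divides 0ℤ (ℤ.+-inverseʳ y)
  hensel M c e y w M∣f M∣f′ (suc n) with hensel M c e y w M∣f M∣f′ n
  ... | z , Mⁿ⁺¹∣fz , M∣z-y = z - f * w , Mⁿ⁺²∣fz′ , M∣z′-y
    where
    newton-step : ∀ c e z w →
      (z - (z * z - c * z + e) * w) * (z - (z * z - c * z + e) * w) - c * (z - (z * z - c * z + e) * w) + e
        ≡ (1ℤ - w * (+ 2 * z - c)) * (z * z - c * z + e) + (z * z - c * z + e) * w * ((z * z - c * z + e) * w)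
    newton-step = solve-∀
    derivative-shift : ∀ w y z c → - (+ 2 * w) * (z - y) - (w * (+ 2 * y - c) - 1ℤ) ≡ 1ℤ - w * (+ 2 * z - c)
    derivative-shift = solve-∀
    f : ℤ
    f = quadratic c e z
    M∣Mⁿ⁺¹ : + M ∣ + (M ℕ.^ suc n)
    M∣Mⁿ⁺¹ = divides (+ (M ℕ.^ n)) (trans (ℤ.pos-* M (M ℕ.^ n)) (ℤ.*-comm (+ M) (+ (M ℕ.^ n))))
    M∣1-wf′ : + M ∣ 1ℤ - w * (+ 2 * z - c)
    M∣1-wf′ = ∣-respʳ (derivative-shift w y z c) (∣m∣n⇒∣m-n (∣n⇒∣m*n (- (+ 2 * w)) M∣z-y) M∣f′)
    Mⁿ⁺²∣fz′ : + (M ℕ.^ suc (suc n)) ∣ quadratic c e (z - f * w)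
    Mⁿ⁺²∣fz′ = subst (_∣ quadratic c e (z - f * w)) (sym (ℤ.pos-* M (M ℕ.^ suc n)))
      (∣-respʳ (sym (newton-step c e z w))
        (∣m∣n⇒∣m+n (*-pres-∣ M∣1-wf′ Mⁿ⁺¹∣fz) (*-pres-∣ (∣m⇒∣m*n w (∣-trans M∣Mⁿ⁺¹ Mⁿ⁺¹∣fz)) (∣m⇒∣m*n w Mⁿ⁺¹∣fz))))
    M∣z′-y : + M ∣ z - f * w - y
    M∣z′-y = ∣-respʳ (regroup z (f * w) y) (∣m∣n⇒∣m-n M∣z-y (∣m⇒∣m*n w (∣-trans M∣Mⁿ⁺¹ Mⁿ⁺¹∣fz)))
      where regroup : ∀ z g y → z - y - g ≡ z - g - y
            regroup = solve-∀

  markoff-as-quadratic : ∀ x₁ x₂ y k → markoffℤ x₁ x₂ y - k ≡ quadratic (x₁ * x₂) (x₁ * x₁ + x₂ * x₂ - k) y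
  markoff-as-quadratic = lemma
    where lemma : ∀ x₁ x₂ y k → x₁ * x₁ + x₂ * x₂ + y * y - x₁ * x₂ * y - k
                              ≡ y * y - x₁ * x₂ * y + (x₁ * x₁ + x₂ * x₂ - k)
          lemma = solve-∀

  solvableMod-^ : ∀ {k} M x₁ x₂ y w → + M ∣ markoffℤ x₁ x₂ y - k → + M ∣ w * (+ 2 * y - x₁ * x₂) - 1ℤ
                → ∀ n → SolvableMod k (M ℕ.^ n)
  solvableMod-^ {k} M x₁ x₂ y w M∣f M∣f′ zero = solvableMod-1 k
  solvableMod-^ {k} M x₁ x₂ y w M∣f M∣f′ (suc n)
    with hensel M (x₁ * x₂) (x₁ * x₁ + x₂ * x₂ - k) y w (∣-respʳ (markoff-as-quadratic x₁ x₂ y k) M∣f) M∣f′ n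
  ... | z , Mⁿ∣f , _ = x₁ , x₂ , z , ∣-respʳ (sym (markoff-as-quadratic x₁ x₂ z k)) Mⁿ∣f

  solvableMod-2^ : ∀ {k} → + 2 ∣ k → ∀ n → SolvableMod k (2 ℕ.^ n)
  solvableMod-2^ 2∣k = solvableMod-^ 2 1ℤ 1ℤ 0ℤ (- 1ℤ) (∣m∣n⇒∣m-n ∣-refl 2∣k) (divides 0ℤ refl)

  solvableMod-3^-k≡1 : ∀ {k} → + 3 ∣ k - 1ℤ → ∀ n → SolvableMod k (3 ℕ.^ n)
  solvableMod-3^-k≡1 {k} 3∣k-1 = solvableMod-^ 3 0ℤ 0ℤ 1ℤ (+ 2) (∣-respʳ (negate k) (∣m⇒∣-m 3∣k-1)) (divides 1ℤ refl)
    where negate : ∀ k → - (k - 1ℤ) ≡ 1ℤ - k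
          negate = solve-∀

  sumOfTwoSquares-mod3 : ∀ c → ∃[ a ] ∃[ b ] + 3 ∣ a * a + b * b - c
  sumOfTwoSquares-mod3 c = subst (λ c → ∃[ a ] ∃[ b ] + 3 ∣ a * a + b * b - c) (sym (a≡a%ℕn+[a/ℕn]*n c 3))
    (byResidue (c %ℕ 3) (c /ℕ 3) (n%ℕd<d c 3))
    where
    cancel : ∀ r q → r - (r + q * + 3) ≡ - q * + 3
    cancel = solve-∀
    byResidue : ∀ r q → r ℕ.< 3 → ∃[ a ] ∃[ b ] + 3 ∣ a * a + b * b - (+ r + q * + 3)
    byResidue 0 q _ = 0ℤ , 0ℤ , divides (- q) (cancel (+ 0) q)
    byResidue 1 q _ = 1ℤ , 0ℤ , divides (- q) (cancel (+ 1) q)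
    byResidue 2 q _ = 1ℤ , 1ℤ , divides (- q) (cancel (+ 2) q)
    byResidue (suc (suc (suc _))) q (s≤s (s≤s (s≤s ())))

  private
    markoff-scaled : ∀ a b y κ → markoffℤ (+ 3 * a) (+ 3 * b) (+ 3 * y) - + 9 * κ
                               ≡ + 9 * quadratic (+ 3 * a * b) (a * a + b * b - κ) y
    markoff-scaled = lemma
      where lemma : ∀ a b y κ → + 3 * a * (+ 3 * a) + + 3 * b * (+ 3 * b) + + 3 * y * (+ 3 * y)
                                  - + 3 * a * (+ 3 * b) * (+ 3 * y) - + 9 * κ
                              ≡ + 9 * (y * y - + 3 * a * b * y + (a * a + b * b - κ))
            lemma = solve-∀

    scaled-seed : ∀ κ a b → + 3 ∣ a * a + b * b - (κ - 1ℤ) → + 3 ∣ quadratic (+ 3 * a * b) (a * a + b * b - κ) 1ℤ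
    scaled-seed κ a b 3∣ = ∣-respʳ (sym (at-one a b κ)) (∣m∣n⇒∣m+n 3∣ (divides (- a * b) refl))
      where at-one : ∀ a b κ → 1ℤ * 1ℤ - + 3 * a * b * 1ℤ + (a * a + b * b - κ) ≡ a * a + b * b - (κ - 1ℤ) + - a * b * + 3
            at-one = solve-∀

    scaled-nonsingular : ∀ a b → + 2 * (+ 2 * 1ℤ - + 3 * a * b) - 1ℤ ≡ (1ℤ - + 2 * a * b) * + 3
    scaled-nonsingular = solve-∀

  -- When 9 ∣ k the only solution modulo 3 is 0, which is singular; so lift a solution of the
  -- equation satisfied by the coordinates divided by 3 instead.
  solvableMod-3^-9∣k : ∀ {k} κ → k ≡ + 9 * κ → ∀ n → SolvableMod k (3 ℕ.^ n)
  solvableMod-3^-9∣k {k} κ _ zero = solvableMod-1 k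
  solvableMod-3^-9∣k κ refl (suc n) with sumOfTwoSquares-mod3 (κ - 1ℤ)
  ... | a , b , 3∣ with hensel 3 (+ 3 * a * b) (a * a + b * b - κ) 1ℤ (+ 2) (scaled-seed κ a b 3∣)
                                (divides (1ℤ - + 2 * a * b) (scaled-nonsingular a b)) n
  ... | y , 3ⁿ⁺¹∣f , _ = + 3 * a , + 3 * b , + 3 * y , ∣-respʳ (sym (markoff-scaled a b y κ)) (∣n⇒∣m*n (+ 9) 3ⁿ⁺¹∣f)

  -- For d ≠ 0, (y₁/d, y₂/d, y₃/d) lies on the surface markoff = k iff homogeneousMarkoff d y₁ y₂ y₃ = k d³.
  homogeneousMarkoff : ℤ → ℤ → ℤ → ℤ → ℤ
  homogeneousMarkoff d y₁ y₂ y₃ = d * (y₁ * y₁ + y₂ * y₂ + y₃ * y₃) - y₁ * y₂ * y₃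

  solvableMod-rationalPoint : ∀ {k m} d y₁ y₂ y₃ → homogeneousMarkoff d y₁ y₂ y₃ ≡ k * (d * d * d)
                            → Unimodular d (+ m) → SolvableMod k m
  solvableMod-rationalPoint {k} {m} d y₁ y₂ y₃ point (u , v , eq) = y₁ * u , y₂ * u , y₃ * u , divides (v * r) (begin
    markoffℤ (y₁ * u) (y₂ * u) (y₃ * u) - k
      ≡⟨ dehomogenise d y₁ y₂ y₃ u k ⟩
    (1ℤ - u * d) * r + u * u * u * (homogeneousMarkoff d y₁ y₂ y₃ - k * (d * d * d))
      ≡⟨ cong₂ (λ s t → s * r + u * u * u * t) 1-ud≡vm (trans (cong (_- k * (d * d * d)) point) (ℤ.+-inverseʳ (k * (d * d * d)))) ⟩
    v * + m * r + u * u * u * 0ℤ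
      ≡⟨ simplify v (+ m) r (u * u * u) ⟩
    v * r * + m ∎)
    where
    open ≡-Reasoning
    r : ℤ
    r = u * u * (y₁ * y₁ + y₂ * y₂ + y₃ * y₃) - k * (1ℤ + u * d + u * d * (u * d))
    1-ud≡vm : 1ℤ - u * d ≡ v * + m
    1-ud≡vm = trans (cong (_- u * d) (sym eq)) (cancel (u * d) (v * + m))
      where cancel : ∀ a b → a + b - a ≡ b
            cancel = solve-∀
    dehomogenise : ∀ d y₁ y₂ y₃ u k →
      y₁ * u * (y₁ * u) + y₂ * u * (y₂ * u) + y₃ * u * (y₃ * u) - y₁ * u * (y₂ * u) * (y₃ * u) - k
        ≡ (1ℤ - u * d) * (u * u * (y₁ * y₁ + y₂ * y₂ + y₃ * y₃) - k * (1ℤ + u * d + u * d * (u * d)))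
          + u * u * u * (d * (y₁ * y₁ + y₂ * y₂ + y₃ * y₃) - y₁ * y₂ * y₃ - k * (d * d * d))
    dehomogenise = solve-∀
    simplify : ∀ v m r c → v * m * r + c * 0ℤ ≡ v * r * m
    simplify = solve-∀

  factorOut : ∀ p → 1 ℕ.< p → ∀ q → .{{ℕ.NonZero q}} → ∃[ a ] ∃[ r ] (q ≡ p ℕ.^ a ℕ.* r × ¬ p ℕ.∣ r)
  factorOut p 1<p q = go q (<-wellFounded q)
    where
    go : ∀ q → .{{ℕ.NonZero q}} → Acc ℕ._<_ q → ∃[ a ] ∃[ r ] (q ≡ p ℕ.^ a ℕ.* r × ¬ p ℕ.∣ r)
    go q (acc smaller) with p ℕ.∣? q
    ... | no p∤q = 0 , q , sym (ℕ.+-identityʳ q) , p∤q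
    ... | yes (ℕ.divides s refl) with go s {{s≢0}} (smaller (ℕ.m<m*n s p {{s≢0}} 1<p))
      where
      s≢0 : ℕ.NonZero s
      s≢0 = ℕ.m*n≢0⇒m≢0 s
    ...   | a , r , refl , p∤r = suc a , r , rotate (p ℕ.^ a) r p , p∤r
      where rotate : ∀ x r p → x ℕ.* r ℕ.* p ≡ p ℕ.* x ℕ.* r
            rotate = ℕ-solve-∀

  prime[3] : Prime 3
  prime[3] = from-yes (prime? 3)

  markoffConstant : ℤ → ℤ
  markoffConstant n = + 4 + + 2 * (n * n)

  markoffConstant-pos : ∀ ν → + (4 ℕ.+ 2 ℕ.* (ν ℕ.* ν)) ≡ markoffConstant (+ ν)
  markoffConstant-pos ν = trans (ℤ.pos-+ 4 (2 ℕ.* (ν ℕ.* ν)))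
    (cong (_+_ (+ 4)) (trans (ℤ.pos-* 2 (ν ℕ.* ν)) (cong (_*_ (+ 2)) (ℤ.pos-* ν ν))))

  markoffConstant-mod9 : ∀ ν → ν ℕ.% 9 ≡ 0 ⊎ ν ℕ.% 9 ≡ 3 ⊎ ν ℕ.% 9 ≡ 6 ⊎ ν ℕ.% 9 ≡ 4 ⊎ ν ℕ.% 9 ≡ 5
                       → + 3 ∣ markoffConstant (+ ν) - 1ℤ ⊎ ∃[ κ ] markoffConstant (+ ν) ≡ + 9 * κ
  markoffConstant-mod9 ν residue = subst (λ n → + 3 ∣ markoffConstant n - 1ℤ ⊎ ∃[ κ ] markoffConstant n ≡ + 9 * κ)
    (sym ν≡r+9s) (byResidue (ν ℕ.% 9) (+ (ν ℕ./ 9)) residue)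
    where
    ν≡r+9s : + ν ≡ + (ν ℕ.% 9) + + (ν ℕ./ 9) * + 9
    ν≡r+9s = trans (cong +_ (ℕ.m≡m%n+[m/n]*n ν 9))
                   (trans (ℤ.pos-+ (ν ℕ.% 9) (ν ℕ./ 9 ℕ.* 9)) (cong (λ t → + (ν ℕ.% 9) + t) (ℤ.pos-* (ν ℕ./ 9) 9)))
    byResidue : ∀ r s → r ≡ 0 ⊎ r ≡ 3 ⊎ r ≡ 6 ⊎ r ≡ 4 ⊎ r ≡ 5
              → + 3 ∣ markoffConstant (+ r + s * + 9) - 1ℤ ⊎ ∃[ κ ] markoffConstant (+ r + s * + 9) ≡ + 9 * κ
    byResidue _ s (inj₁ refl) = inj₁ (divides (1ℤ + + 54 * (s * s)) (id₀ s))
      where id₀ : ∀ s → + 4 + + 2 * ((+ 0 + s * + 9) * (+ 0 + s * + 9)) - 1ℤ ≡ (1ℤ + + 54 * (s * s)) * + 3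
            id₀ = solve-∀
    byResidue _ s (inj₂ (inj₁ refl)) = inj₁ (divides (+ 7 + + 36 * s + + 54 * (s * s)) (id₃ s))
      where id₃ : ∀ s → + 4 + + 2 * ((+ 3 + s * + 9) * (+ 3 + s * + 9)) - 1ℤ ≡ (+ 7 + + 36 * s + + 54 * (s * s)) * + 3
            id₃ = solve-∀
    byResidue _ s (inj₂ (inj₂ (inj₁ refl))) = inj₁ (divides (+ 25 + + 72 * s + + 54 * (s * s)) (id₆ s))
      where id₆ : ∀ s → + 4 + + 2 * ((+ 6 + s * + 9) * (+ 6 + s * + 9)) - 1ℤ ≡ (+ 25 + + 72 * s + + 54 * (s * s)) * + 3
            id₆ = solve-∀
    byResidue _ s (inj₂ (inj₂ (inj₂ (inj₁ refl)))) = inj₂ (+ 4 + + 16 * s + + 18 * (s * s) , id₄ s)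
      where id₄ : ∀ s → + 4 + + 2 * ((+ 4 + s * + 9) * (+ 4 + s * + 9)) ≡ + 9 * (+ 4 + + 16 * s + + 18 * (s * s))
            id₄ = solve-∀
    byResidue _ s (inj₂ (inj₂ (inj₂ (inj₂ refl)))) = inj₂ (+ 6 + + 20 * s + + 18 * (s * s) , id₅ s)
      where id₅ : ∀ s → + 4 + + 2 * ((+ 5 + s * + 9) * (+ 5 + s * + 9)) ≡ + 9 * (+ 6 + + 20 * s + + 18 * (s * s))
            id₅ = solve-∀

  solvableMod-coprimeTo6 : ∀ n r → ¬ 2 ℕ.∣ r → ¬ 3 ℕ.∣ r → SolvableMod (markoffConstant n) r
  solvableMod-coprimeTo6 n r 2∤r 3∤r =
    solvableMod-rationalPoint (+ 18) (+ 45) (+ 36 - + 16 * (n * n)) (+ 45 - + 32 * (n * n)) (point n)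
      (unimodular-*ˡ (prime⇒unimodular prime[2] 2∤r) (unimodular-*ˡ 3⊥r 3⊥r))
    where
    3⊥r : Unimodular (+ 3) (+ r)
    3⊥r = prime⇒unimodular prime[3] 3∤r
    point : ∀ n → + 18 * (+ 45 * + 45 + (+ 36 - + 16 * (n * n)) * (+ 36 - + 16 * (n * n))
                             + (+ 45 - + 32 * (n * n)) * (+ 45 - + 32 * (n * n)))
                  - + 45 * (+ 36 - + 16 * (n * n)) * (+ 45 - + 32 * (n * n))
                ≡ (+ 4 + + 2 * (n * n)) * (+ 18 * + 18 * + 18)
    point = solve-∀

  localSolvability : ∀ ν → ν ℕ.% 9 ≡ 0 ⊎ ν ℕ.% 9 ≡ 3 ⊎ ν ℕ.% 9 ≡ 6 ⊎ ν ℕ.% 9 ≡ 4 ⊎ ν ℕ.% 9 ≡ 5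
                   → ∀ q → .{{ℕ.NonZero q}} → SolvableMod (markoffConstant (+ ν)) q
  localSolvability ν residue q with factorOut 2 (ℕ.s≤s (ℕ.s≤s ℕ.z≤n)) q
  ... | a , q₁ , refl , 2∤q₁ with factorOut 3 (ℕ.s≤s (ℕ.s≤s ℕ.z≤n)) q₁ {{ℕ.m*n≢0⇒n≢0 (2 ℕ.^ a)}}
  ... | b , r , refl , 3∤r =
    solvableMod-* (unimodular-^ˡ (prime⇒unimodular prime[2] 2∤q₁) a) (solvableMod-2^ (divides (+ 2 + + ν * + ν) (even (+ ν))) a)
      (solvableMod-* (unimodular-^ˡ (prime⇒unimodular prime[3] 3∤r) b) (solvableMod-3-adic b)
        (solvableMod-coprimeTo6 (+ ν) r (λ 2∣r → 2∤q₁ (ℕ.∣n⇒∣m*n (3 ℕ.^ b) 2∣r)) 3∤r))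
    where
    even : ∀ n → + 4 + + 2 * (n * n) ≡ (+ 2 + n * n) * + 2
    even = solve-∀
    solvableMod-3-adic : ∀ b → SolvableMod (markoffConstant (+ ν)) (3 ℕ.^ b)
    solvableMod-3-adic with markoffConstant-mod9 ν residue
    ... | inj₁ 3∣k-1 = solvableMod-3^-k≡1 3∣k-1
    ... | inj₂ (κ , k≡9κ) = solvableMod-3^-9∣k κ k≡9κ

module ModEight where
  open import Defs using (PlusMinusOneMod8)
  open import Data.Nat as ℕ using (ℕ; suc)
  import Data.Nat.Properties as ℕ
  import Data.Nat.Divisibility as ℕ
  import Data.Nat.DivMod as ℕ
  open import Data.Nat.ListAction using (product)
  open import Data.Nat.ListAction.Properties using (∈⇒∣product)
  open import Data.Nat.Primality using (Prime)
  open import Data.Nat.Primality.Factorisation using (factorise; PrimeFactorisation)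
  open import Data.List using ([]; _∷_)
  open import Data.List.Relation.Unary.All as All using (All; []; _∷_)
  open import Data.Integer as ℤ using (ℤ; +_; _+_; _*_; _-_; -_; 0ℤ; 1ℤ)
  import Data.Integer.Properties as ℤ
  open import Data.Integer.DivMod using (_%ℕ_; _/ℕ_; n%ℕd<d; a≡a%ℕn+[a/ℕn]*n)
  open import Data.Integer.Divisibility.Signed using (_∣_; divides; ∣⇒∣ᵤ; ∣ᵤ⇒∣)
  open import Data.Integer.Tactic.RingSolver using (solve-∀)
  open import Data.Product using (∃-syntax; _,_)
  open import Data.Sum using (_⊎_; inj₁; inj₂; [_,_]′)
  open import Data.Empty using (⊥-elim)
  open import Function using (_∘_)
  open import Relation.Nullary using (¬_)
  open import Relation.Binary.PropositionalEquality

  PlusMinusOneMod8ℤ : ℤ → Set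
  PlusMinusOneMod8ℤ x = ∃[ j ] (x ≡ + 8 * j + 1ℤ ⊎ x ≡ + 8 * j - 1ℤ)

  pm8-1 : PlusMinusOneMod8ℤ 1ℤ
  pm8-1 = 0ℤ , inj₁ refl

  pm8-* : ∀ {x y} → PlusMinusOneMod8ℤ x → PlusMinusOneMod8ℤ y → PlusMinusOneMod8ℤ (x * y)
  pm8-* (j , inj₁ refl) (k , inj₁ refl) = + 8 * j * k + j + k , inj₁ (lemma j k)
    where lemma : ∀ j k → (+ 8 * j + 1ℤ) * (+ 8 * k + 1ℤ) ≡ + 8 * (+ 8 * j * k + j + k) + 1ℤ
          lemma = solve-∀
  pm8-* (j , inj₁ refl) (k , inj₂ refl) = + 8 * j * k - j + k , inj₂ (lemma j k)
    where lemma : ∀ j k → (+ 8 * j + 1ℤ) * (+ 8 * k - 1ℤ) ≡ + 8 * (+ 8 * j * k - j + k) - 1ℤ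
          lemma = solve-∀
  pm8-* (j , inj₂ refl) (k , inj₁ refl) = + 8 * j * k + j - k , inj₂ (lemma j k)
    where lemma : ∀ j k → (+ 8 * j - 1ℤ) * (+ 8 * k + 1ℤ) ≡ + 8 * (+ 8 * j * k + j - k) - 1ℤ
          lemma = solve-∀
  pm8-* (j , inj₂ refl) (k , inj₂ refl) = + 8 * j * k - j - k , inj₁ (lemma j k)
    where lemma : ∀ j k → (+ 8 * j - 1ℤ) * (+ 8 * k - 1ℤ) ≡ + 8 * (+ 8 * j * k - j - k) + 1ℤ
          lemma = solve-∀

  pm8-neg : ∀ {x} → PlusMinusOneMod8ℤ x → PlusMinusOneMod8ℤ (- x)
  pm8-neg (j , inj₁ refl) = - j , inj₂ (lemma j)
    where lemma : ∀ j → - (+ 8 * j + 1ℤ) ≡ + 8 * (- j) - 1ℤ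
          lemma = solve-∀
  pm8-neg (j , inj₂ refl) = - j , inj₁ (lemma j)
    where lemma : ∀ j → - (+ 8 * j - 1ℤ) ≡ + 8 * (- j) + 1ℤ
          lemma = solve-∀

  pm8-fromℕ : ∀ n → PlusMinusOneMod8 n → PlusMinusOneMod8ℤ (+ n)
  pm8-fromℕ n residue = subst PlusMinusOneMod8ℤ (sym n≡r+8q) (byResidue (n ℕ.% 8) (+ (n ℕ./ 8)) residue)
    where
    n≡r+8q : + n ≡ + (n ℕ.% 8) + + 8 * + (n ℕ./ 8)
    n≡r+8q = trans (cong +_ (trans (ℕ.m≡m%n+[m/n]*n n 8) (cong (n ℕ.% 8 ℕ.+_) (ℕ.*-comm (n ℕ./ 8) 8))))
                   (trans (ℤ.pos-+ (n ℕ.% 8) (8 ℕ.* (n ℕ./ 8))) (cong (λ t → + (n ℕ.% 8) + t) (ℤ.pos-* 8 (n ℕ./ 8))))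
    byResidue : ∀ r q → r ≡ 1 ⊎ r ≡ 7 → PlusMinusOneMod8ℤ (+ r + + 8 * q)
    byResidue _ q (inj₁ refl) = q , inj₁ (ℤ.+-comm 1ℤ (+ 8 * q))
    byResidue _ q (inj₂ refl) = q + 1ℤ , inj₂ (lemma q)
      where lemma : ∀ q → + 7 + + 8 * q ≡ + 8 * (q + 1ℤ) - 1ℤ
            lemma = solve-∀

  pm8-product : ∀ ns → All (PlusMinusOneMod8ℤ ∘ +_) ns → PlusMinusOneMod8ℤ (+ product ns)
  pm8-product [] [] = pm8-1
  pm8-product (n ∷ ns) (pm₁ ∷ pms) = subst PlusMinusOneMod8ℤ (sym (ℤ.pos-* n (product ns))) (pm8-* pm₁ (pm8-product ns pms))

  pm8-of-primeFactorsℕ : ∀ n → .{{ℕ.NonZero n}} → (∀ p → Prime p → p ℕ.∣ n → PlusMinusOneMod8ℤ (+ p))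
                       → PlusMinusOneMod8ℤ (+ n)
  pm8-of-primeFactorsℕ n factors-pm8 = subst (PlusMinusOneMod8ℤ ∘ +_) (sym isFactorisation)
    (pm8-product factors (All.tabulate λ p∈ →
      factors-pm8 _ (All.lookup factorsPrime p∈) (subst (_ ℕ.∣_) (sym isFactorisation) (∈⇒∣product p∈))))
    where open PrimeFactorisation (factorise n)

  pm8-of-primeFactors : ∀ x → x ≢ 0ℤ → (∀ p → Prime p → + p ∣ x → PlusMinusOneMod8ℤ (+ p)) → PlusMinusOneMod8ℤ x
  pm8-of-primeFactors x x≢0 factors-pm8 =
    [ (λ ∣x∣≡x → subst PlusMinusOneMod8ℤ ∣x∣≡x pm8-∣x∣)
    , (λ ∣x∣≡-x → subst PlusMinusOneMod8ℤ (ℤ.neg-involutive x) (pm8-neg (subst PlusMinusOneMod8ℤ ∣x∣≡-x pm8-∣x∣)))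
    ]′ (ℤ.+∣i∣≡i⊎+∣i∣≡-i x)
    where
    pm8-∣x∣ : PlusMinusOneMod8ℤ (+ ℤ.∣ x ∣)
    pm8-∣x∣ = pm8-of-primeFactorsℕ ℤ.∣ x ∣ {{ℕ.≢-nonZero (x≢0 ∘ ℤ.∣i∣≡0⇒i≡0)}}
      λ p p-prime p∣x → factors-pm8 p p-prime (∣ᵤ⇒∣ p∣x)

  Odd : ℤ → Set
  Odd x = ∃[ s ] x ≡ + 2 * s + 1ℤ

  parity : ∀ x → ∃[ t ] x ≡ + 2 * t ⊎ Odd x
  parity x = subst (λ x → ∃[ t ] x ≡ + 2 * t ⊎ Odd x) (sym (a≡a%ℕn+[a/ℕn]*n x 2)) (byResidue (x %ℕ 2) (x /ℕ 2) (n%ℕd<d x 2))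
    where
    byResidue : ∀ r q → r ℕ.< 2 → ∃[ t ] + r + q * + 2 ≡ + 2 * t ⊎ Odd (+ r + q * + 2)
    byResidue 0 q _ = inj₁ (q , lemma q)
      where lemma : ∀ q → + 0 + q * + 2 ≡ + 2 * q
            lemma = solve-∀
    byResidue 1 q _ = inj₂ (q , lemma q)
      where lemma : ∀ q → + 1 + q * + 2 ≡ + 2 * q + 1ℤ
            lemma = solve-∀
    byResidue (suc (suc _)) q (ℕ.s≤s (ℕ.s≤s ()))

  even≢odd : ∀ a b → + 2 * a ≢ + 2 * b + 1ℤ
  even≢odd a b eq with ℕ.∣1⇒≡1 (∣⇒∣ᵤ (divides {+ 2} {1ℤ} (a - b) (begin
    1ℤ                      ≡⟨ lemma₁ b ⟩
    + 2 * b + 1ℤ - + 2 * b  ≡⟨ cong (_- + 2 * b) eq ⟨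
    + 2 * a - + 2 * b       ≡⟨ lemma₂ a b ⟩
    (a - b) * + 2           ∎)))
    where
    open ≡-Reasoning
    lemma₁ : ∀ b → 1ℤ ≡ + 2 * b + 1ℤ - + 2 * b
    lemma₁ = solve-∀
    lemma₂ : ∀ a b → + 2 * a - + 2 * b ≡ (a - b) * + 2
    lemma₂ = solve-∀
  ... | ()

  ¬2∣⇒odd : ∀ x → ¬ + 2 ∣ x → Odd x
  ¬2∣⇒odd x 2∤x with parity x
  ... | inj₁ (t , x≡2t) = ⊥-elim (2∤x (divides t (trans x≡2t (ℤ.*-comm (+ 2) t))))
  ... | inj₂ odd = odd

  odd-square : ∀ {x} → Odd x → ∃[ J ] x * x ≡ + 8 * J + 1ℤ
  odd-square (s , refl) with parity s
  ... | inj₁ (t , refl) = t * (+ 2 * t + 1ℤ) , lemma t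
    where lemma : ∀ t → (+ 2 * (+ 2 * t) + 1ℤ) * (+ 2 * (+ 2 * t) + 1ℤ) ≡ + 8 * (t * (+ 2 * t + 1ℤ)) + 1ℤ
          lemma = solve-∀
  ... | inj₂ (t , refl) = (+ 2 * t + 1ℤ) * (t + 1ℤ) , lemma t
    where lemma : ∀ t → (+ 2 * (+ 2 * t + 1ℤ) + 1ℤ) * (+ 2 * (+ 2 * t + 1ℤ) + 1ℤ) ≡ + 8 * ((+ 2 * t + 1ℤ) * (t + 1ℤ)) + 1ℤ
          lemma = solve-∀

  ¬pm8-2 : ¬ PlusMinusOneMod8ℤ (+ 2)
  ¬pm8-2 (j , inj₁ 2≡8j+1) = even≢odd 1ℤ (+ 4 * j) (trans 2≡8j+1 (lemma j))
    where lemma : ∀ j → + 8 * j + 1ℤ ≡ + 2 * (+ 4 * j) + 1ℤ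
          lemma = solve-∀
  ¬pm8-2 (j , inj₂ 2≡8j-1) = even≢odd 1ℤ (+ 4 * j - 1ℤ) (trans 2≡8j-1 (lemma j))
    where lemma : ∀ j → + 8 * j - 1ℤ ≡ + 2 * (+ 4 * j - 1ℤ) + 1ℤ
          lemma = solve-∀

  ¬pm8-5 : ∀ {x} k → x ≡ + 8 * k + + 5 → ¬ PlusMinusOneMod8ℤ x
  ¬pm8-5 k refl (j , inj₁ eq) = even≢odd (j - k) 0ℤ (ℤ.*-cancelˡ-≡ (+ 4) _ _ (begin
    + 4 * (+ 2 * (j - k))                     ≡⟨ lemma₁ j k ⟩
    + 8 * j + 1ℤ - (+ 8 * k + + 5) + + 4      ≡⟨ cong (λ t → t - (+ 8 * k + + 5) + + 4) eq ⟨
    + 8 * k + + 5 - (+ 8 * k + + 5) + + 4     ≡⟨ lemma₂ k ⟩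
    + 4 * (+ 2 * 0ℤ + 1ℤ)                     ∎))
    where
    open ≡-Reasoning
    lemma₁ : ∀ j k → + 4 * (+ 2 * (j - k)) ≡ + 8 * j + 1ℤ - (+ 8 * k + + 5) + + 4
    lemma₁ = solve-∀
    lemma₂ : ∀ k → + 8 * k + + 5 - (+ 8 * k + + 5) + + 4 ≡ + 4 * (+ 2 * 0ℤ + 1ℤ)
    lemma₂ = solve-∀
  ¬pm8-5 k refl (j , inj₂ eq) = even≢odd (+ 2 * (j - k)) 1ℤ (ℤ.*-cancelˡ-≡ (+ 2) _ _ (begin
    + 2 * (+ 2 * (+ 2 * (j - k)))             ≡⟨ lemma₁ j k ⟩
    + 8 * j - 1ℤ - (+ 8 * k + + 5) + + 6      ≡⟨ cong (λ t → t - (+ 8 * k + + 5) + + 6) eq ⟨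
    + 8 * k + + 5 - (+ 8 * k + + 5) + + 6     ≡⟨ lemma₂ k ⟩
    + 2 * (+ 2 * 1ℤ + 1ℤ)                     ∎))
    where
    open ≡-Reasoning
    lemma₁ : ∀ j k → + 2 * (+ 2 * (+ 2 * (j - k))) ≡ + 8 * j - 1ℤ - (+ 8 * k + + 5) + + 6
    lemma₁ = solve-∀
    lemma₂ : ∀ k → + 8 * k + + 5 - (+ 8 * k + + 5) + + 6 ≡ + 2 * (+ 2 * 1ℤ + 1ℤ)
    lemma₂ = solve-∀

  pm8-twiceSquare-oddSquare : ∀ a b → Odd a → PlusMinusOneMod8ℤ (+ 2 * (b * b) - a * a)
  pm8-twiceSquare-oddSquare a b odd with odd-square odd | parity b
  ... | J , a²≡8J+1 | inj₁ (t , refl) =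
    t * t - J , inj₂ (trans (cong (λ s → + 2 * (+ 2 * t * (+ 2 * t)) - s) a²≡8J+1) (lemma t J))
    where lemma : ∀ t J → + 2 * (+ 2 * t * (+ 2 * t)) - (+ 8 * J + 1ℤ) ≡ + 8 * (t * t - J) - 1ℤ
          lemma = solve-∀
  ... | J , a²≡8J+1 | inj₂ (t , refl) =
    t * t + t - J , inj₁ (trans (cong (λ s → + 2 * ((+ 2 * t + 1ℤ) * (+ 2 * t + 1ℤ)) - s) a²≡8J+1) (lemma t J))
    where lemma : ∀ t J → + 2 * ((+ 2 * t + 1ℤ) * (+ 2 * t + 1ℤ)) - (+ 8 * J + 1ℤ) ≡ + 8 * (t * t + t - J) + 1ℤ
          lemma = solve-∀

module QuadraticCharacterOfTwo where
  open Divisibility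
  open ModEight
  open import Data.Nat as ℕ using (ℕ; zero; suc)
  import Data.Nat.Properties as ℕ
  import Data.Nat.Divisibility as ℕ
  open import Data.Nat.Induction using (<-wellFounded)
  open import Data.Nat.Primality using (Prime; euclidsLemma; prime⇒irreducible; prime⇒nonZero; prime[2]; ¬prime[1])
  open import Data.Nat.Tactic.RingSolver using () renaming (solve-∀ to ℕ-solve-∀)
  open import Data.Fin as Fin using (Fin; toℕ; fromℕ<; remQuot; combine)
  import Data.Fin.Properties as Fin
  open import Data.Integer as ℤ using (ℤ; +_; _+_; _*_; _-_; -_; 0ℤ)
  import Data.Integer.Properties as ℤ
  open import Data.Integer.DivMod using (_%ℕ_; _/ℕ_; n%ℕd<d; a≡a%ℕn+[a/ℕn]*n)
  open import Data.Integer.Divisibility.Signed using (_∣_; divides; ∣⇒∣ᵤ; ∣m∣n⇒∣m+n; ∣m⇒∣-m; ∣m⇒∣m*n; ∣n⇒∣m*n)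
  open import Data.Integer.Tactic.RingSolver using (solve-∀)
  open import Data.Product using (∃-syntax; ∃₂; _×_; _,_; proj₁; proj₂)
  open import Data.Sum using (_⊎_; inj₁; inj₂; [_,_]′)
  open import Data.Empty using (⊥-elim)
  open import Function using (_∘_; id)
  open import Induction.WellFounded using (Acc; acc)
  open import Relation.Nullary using (¬_; Dec; yes; no)
  open import Relation.Binary.PropositionalEquality

  square-cancel-< : ∀ {m n} → m ℕ.* m ℕ.< n ℕ.* n → m ℕ.< n
  square-cancel-< m²<n² = ℕ.≰⇒> λ n≤m → ℕ.<⇒≱ m²<n² (ℕ.*-mono-≤ n≤m n≤m)

  √2-irrational : ∀ a b → a ℕ.* a ≡ 2 ℕ.* (b ℕ.* b) → b ≡ 0
  √2-irrational a = descend a (<-wellFounded a)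
    where
    halve : ∀ b c → c ℕ.* 2 ℕ.* (c ℕ.* 2) ≡ 2 ℕ.* (b ℕ.* b) → b ℕ.* b ≡ 2 ℕ.* (c ℕ.* c)
    halve b c eq = ℕ.*-cancelˡ-≡ (b ℕ.* b) (2 ℕ.* (c ℕ.* c)) 2 (trans (sym eq) (double c))
      where double : ∀ c → c ℕ.* 2 ℕ.* (c ℕ.* 2) ≡ 2 ℕ.* (2 ℕ.* (c ℕ.* c))
            double = ℕ-solve-∀
    descend : ∀ a → Acc ℕ._<_ a → ∀ b → a ℕ.* a ≡ 2 ℕ.* (b ℕ.* b) → b ≡ 0
    descend a _ zero _ = refl
    descend a (acc smaller) b@(suc _) a²≡2b²
      with [ id , id ]′ (euclidsLemma a a prime[2] (ℕ.divides (b ℕ.* b) (trans a²≡2b² (ℕ.*-comm 2 (b ℕ.* b)))))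
    ... | ℕ.divides c refl = ⊥-elim (ℕ.1+n≢0 (trans b²≡2c² (cong (λ c → 2 ℕ.* (c ℕ.* c)) c≡0)))
      where
      b²≡2c² : b ℕ.* b ≡ 2 ℕ.* (c ℕ.* c)
      b²≡2c² = halve b c a²≡2b²
      b<a : b ℕ.< c ℕ.* 2
      b<a = square-cancel-< (subst (b ℕ.* b ℕ.<_) (sym a²≡2b²) (ℕ.m<m+n (b ℕ.* b) ℕ.z<s))
      c≡0 : c ≡ 0
      c≡0 = descend b (smaller b<a) c b²≡2c²

  isqrt : ∀ n → ∃[ m ] (m ℕ.* m ℕ.≤ n × n ℕ.< suc m ℕ.* suc m)
  isqrt zero = 0 , ℕ.z≤n , ℕ.s≤s ℕ.z≤n
  isqrt (suc n) with isqrt n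
  ... | m , m²≤n , n<[m+1]² with suc n ℕ.<? suc m ℕ.* suc m
  ...   | yes n+1<[m+1]² = m , ℕ.m≤n⇒m≤1+n m²≤n , n+1<[m+1]²
  ...   | no n+1≮[m+1]² = suc m , ℕ.≮⇒≥ n+1≮[m+1]² ,
                          ℕ.≤-<-trans n<[m+1]² (ℕ.*-mono-< (ℕ.n<1+n (suc m)) (ℕ.n<1+n (suc m)))

  prime≢square : ∀ {p} m → Prime p → m ℕ.* m ≢ p
  prime≢square m p-prime refl with prime⇒irreducible p-prime (ℕ.m∣m*n {m} m)
  ... | inj₁ refl = ¬prime[1] p-prime
  ... | inj₂ m≡m² = ¬prime[1] (subst (λ k → Prime (k ℕ.* k)) m≡1 p-prime)
    where
    instance _ = ℕ.m*n≢0⇒m≢0 m {{prime⇒nonZero p-prime}}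
    m≡1 : m ≡ 1
    m≡1 = ℕ.*-cancelʳ-≡ m 1 m (trans (sym m≡m²) (sym (ℕ.*-identityˡ m)))

  prime-even⇒≡2 : ∀ {p} → Prime p → 2 ℕ.∣ p → p ≡ 2
  prime-even⇒≡2 p-prime 2∣p = [ (λ ()) , sym ]′ (prime⇒irreducible p-prime 2∣p)

  ∣∧<2*⇒≡0⊎≡ : ∀ {p d} → p ℕ.∣ d → d ℕ.< 2 ℕ.* p → d ≡ 0 ⊎ d ≡ p
  ∣∧<2*⇒≡0⊎≡ (ℕ.divides 0 refl) _ = inj₁ refl
  ∣∧<2*⇒≡0⊎≡ {p} (ℕ.divides 1 refl) _ = inj₂ (ℕ.+-identityʳ p)
  ∣∧<2*⇒≡0⊎≡ {p} (ℕ.divides (suc (suc k)) refl) kp<2p =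
    ⊥-elim (ℕ.<⇒≱ kp<2p (ℕ.*-monoˡ-≤ p {2} {suc (suc k)} (ℕ.s≤s (ℕ.s≤s ℕ.z≤n))))

  module _ {n} .{{_ : ℕ.NonZero n}} where

    residue : ℤ → Fin n
    residue x = fromℕ< (n%ℕd<d x n)

    residue-≡⇒∣ : ∀ x y → residue x ≡ residue y → + n ∣ x - y
    residue-≡⇒∣ x y same = divides (x /ℕ n - y /ℕ n) (begin
      x - y                                              ≡⟨ cong₂ _-_ (a≡a%ℕn+[a/ℕn]*n x n) (a≡a%ℕn+[a/ℕn]*n y n) ⟩
      + (x %ℕ n) + x /ℕ n * + n - (+ (y %ℕ n) + y /ℕ n * + n)  ≡⟨ cong (λ r → + r + x /ℕ n * + n - (+ (y %ℕ n) + y /ℕ n * + n)) x%n≡y%n ⟩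
      + (y %ℕ n) + x /ℕ n * + n - (+ (y %ℕ n) + y /ℕ n * + n)  ≡⟨ cancel (+ (y %ℕ n)) (x /ℕ n) (y /ℕ n) (+ n) ⟩
      (x /ℕ n - y /ℕ n) * + n                            ∎)
      where
      open ≡-Reasoning
      x%n≡y%n : x %ℕ n ≡ y %ℕ n
      x%n≡y%n = trans (sym (Fin.toℕ-fromℕ< (n%ℕd<d x n))) (trans (cong toℕ same) (Fin.toℕ-fromℕ< (n%ℕd<d y n)))
      cancel : ∀ r q q′ n → r + q * n - (r + q′ * n) ≡ (q - q′) * n
      cancel = solve-∀

  module _ {m : ℕ} where

    distance : Fin (suc m) → Fin (suc m) → ℤ
    distance u v = + toℕ u - + toℕ v

    ∣distance∣≤ : ∀ u v → ℤ.∣ distance u v ∣ ℕ.≤ m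
    ∣distance∣≤ u v = subst (ℕ._≤ m) (cong ℤ.∣_∣ (sym (ℤ.m-n≡m⊖n (toℕ u) (toℕ v))))
      (ℕ.≤-trans (ℤ.∣m⊝n∣≤m⊔n (toℕ u) (toℕ v)) (ℕ.⊔-lub (ℕ.≤-pred (Fin.toℕ<n u)) (ℕ.≤-pred (Fin.toℕ<n v))))

    distance≡0⇒≡ : ∀ u v → distance u v ≡ 0ℤ → u ≡ v
    distance≡0⇒≡ u v d≡0 = Fin.toℕ-injective (ℤ.+-injective (ℤ.i-j≡0⇒i≡j (+ toℕ u) (+ toℕ v) d≡0))

  thue : ∀ n → .{{ℕ.NonZero n}} → ∀ m (y z : ℤ) → n ℕ.< suc m ℕ.* suc m
       → ∃[ A ] ∃[ B ] (¬ (A ≡ 0ℤ × B ≡ 0ℤ) × ℤ.∣ A ∣ ℕ.≤ m × ℤ.∣ B ∣ ℕ.≤ m × + n ∣ A * y - B * z)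
  thue n m y z n<[m+1]² = fromCollision (Fin.pigeonhole n<[m+1]² (residue ∘ value))
    where
    coordinates : Fin (suc m ℕ.* suc m) → Fin (suc m) × Fin (suc m)
    coordinates = remQuot {suc m} (suc m)
    value : Fin (suc m ℕ.* suc m) → ℤ
    value k = + toℕ (proj₁ (coordinates k)) * y - + toℕ (proj₂ (coordinates k)) * z
    fromCollision : ∃₂ (λ i j → i Fin.< j × residue (value i) ≡ residue (value j))
                  → ∃[ A ] ∃[ B ] (¬ (A ≡ 0ℤ × B ≡ 0ℤ) × ℤ.∣ A ∣ ℕ.≤ m × ℤ.∣ B ∣ ℕ.≤ m × + n ∣ A * y - B * z)
    fromCollision (i , j , i<j , same) =
      distance a₁ a₂ , distance b₁ b₂ , Fin.<⇒≢ i<j ∘ i≡j , ∣distance∣≤ a₁ a₂ , ∣distance∣≤ b₁ b₂ ,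
      subst (+ n ∣_) (regroup (+ toℕ a₁) (+ toℕ a₂) (+ toℕ b₁) (+ toℕ b₂) y z) (residue-≡⇒∣ (value i) (value j) same)
      where
      a₁ b₁ a₂ b₂ : Fin (suc m)
      a₁ = proj₁ (coordinates i)
      b₁ = proj₂ (coordinates i)
      a₂ = proj₁ (coordinates j)
      b₂ = proj₂ (coordinates j)
      i≡j : distance a₁ a₂ ≡ 0ℤ × distance b₁ b₂ ≡ 0ℤ → i ≡ j
      i≡j (a₁-a₂≡0 , b₁-b₂≡0) = begin
        i              ≡⟨ Fin.combine-remQuot {suc m} (suc m) i ⟨
        combine a₁ b₁  ≡⟨ cong₂ combine (distance≡0⇒≡ a₁ a₂ a₁-a₂≡0) (distance≡0⇒≡ b₁ b₂ b₁-b₂≡0) ⟩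
        combine a₂ b₂  ≡⟨ Fin.combine-remQuot {suc m} (suc m) j ⟩
        j              ∎
        where open ≡-Reasoning
      regroup : ∀ a₁ a₂ b₁ b₂ y z → a₁ * y - b₁ * z - (a₂ * y - b₂ * z) ≡ (a₁ - a₂) * y - (b₁ - b₂) * z
      regroup = solve-∀

  square-abs : ∀ a → a * a ≡ + ℤ.∣ a ∣ * + ℤ.∣ a ∣
  square-abs a with ℤ.+∣i∣≡i⊎+∣i∣≡-i a
  ... | inj₁ ∣a∣≡a = cong₂ _*_ (sym ∣a∣≡a) (sym ∣a∣≡a)
  ... | inj₂ ∣a∣≡-a = trans (negate a) (cong₂ _*_ (sym ∣a∣≡-a) (sym ∣a∣≡-a))
    where negate : ∀ a → a * a ≡ - a * - a
          negate = solve-∀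

  ∣⇒∣∸ : ∀ {p a b} → b ℕ.≤ a → + p ∣ + a - + b → p ℕ.∣ a ℕ.∸ b
  ∣⇒∣∸ {p} {a} {b} b≤a p∣a-b = ∣⇒∣ᵤ (subst (+ p ∣_) (trans (ℤ.m-n≡m⊖n a b) (ℤ.⊖-≥ b≤a)) p∣a-b)

  prime-as-norm : ∀ {p} α β → Prime p → α ℕ.* α ℕ.< p → β ℕ.* β ℕ.< p → ¬ (α ≡ 0 × β ≡ 0)
                → + p ∣ + α * + α - + 2 * (+ β * + β) → + p ≡ + 2 * (+ β * + β) - + α * + α
  prime-as-norm {p} α β p-prime α²<p β²<p αβ≢0 p∣norm = byCases (w ℕ.≤? u)
    where
    u w : ℕ
    u = α ℕ.* α
    w = 2 ℕ.* (β ℕ.* β)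
    +u≡α² : + u ≡ + α * + α
    +u≡α² = ℤ.pos-* α α
    +w≡2β² : + w ≡ + 2 * (+ β * + β)
    +w≡2β² = trans (ℤ.pos-* 2 (β ℕ.* β)) (cong (+ 2 *_) (ℤ.pos-* β β))
    p∣u-w : + p ∣ + u - + w
    p∣u-w = subst (+ p ∣_) (sym (cong₂ _-_ +u≡α² +w≡2β²)) p∣norm
    u<2p : u ℕ.< 2 ℕ.* p
    u<2p = ℕ.<-≤-trans α²<p (ℕ.m≤m+n p (p ℕ.+ 0))
    byCases : Dec (w ℕ.≤ u) → + p ≡ + 2 * (+ β * + β) - + α * + α
    byCases (yes w≤u) = ⊥-elim ([ u≢w ∘ u∸w≡0⇒u≡w , ℕ.<⇒≱ α²<p ∘ u∸w≡p⇒p≤u ]′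
                          (∣∧<2*⇒≡0⊎≡ (∣⇒∣∸ w≤u p∣u-w) (ℕ.≤-<-trans (ℕ.m∸n≤m u w) u<2p)))
      where
      u∸w≡0⇒u≡w : u ℕ.∸ w ≡ 0 → u ≡ w
      u∸w≡0⇒u≡w u∸w≡0 = ℕ.≤-antisym (ℕ.m∸n≡0⇒m≤n u∸w≡0) w≤u
      u∸w≡p⇒p≤u : u ℕ.∸ w ≡ p → p ℕ.≤ u
      u∸w≡p⇒p≤u u∸w≡p = subst (ℕ._≤ u) u∸w≡p (ℕ.m∸n≤m u w)
      u≢w : u ≢ w
      u≢w u≡w = αβ≢0 ([ id , id ]′ (ℕ.m*n≡0⇒m≡0∨n≡0 α (subst (λ b → u ≡ 2 ℕ.* (b ℕ.* b)) β≡0 u≡w)) , β≡0)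
        where β≡0 = √2-irrational α β u≡w
    byCases (no w≰u) = [ (λ w∸u≡0 → ⊥-elim (ℕ.m>n⇒m∸n≢0 (ℕ.≰⇒> w≰u) w∸u≡0)) , p≡w-u ]′
                         (∣∧<2*⇒≡0⊎≡ (∣⇒∣∸ u≤w p∣w-u) (ℕ.≤-<-trans (ℕ.m∸n≤m w u) (ℕ.*-monoʳ-< 2 β²<p)))
      where
      u≤w : u ℕ.≤ w
      u≤w = ℕ.<⇒≤ (ℕ.≰⇒> w≰u)
      p∣w-u : + p ∣ + w - + u
      p∣w-u = subst (+ p ∣_) (negate (+ u) (+ w)) (∣m⇒∣-m p∣u-w)
        where negate : ∀ a b → - (a - b) ≡ b - a
              negate = solve-∀
      p≡w-u : w ℕ.∸ u ≡ p → + p ≡ + 2 * (+ β * + β) - + α * + α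
      p≡w-u w∸u≡p = begin
        + p              ≡⟨ cong +_ w∸u≡p ⟨
        + (w ℕ.∸ u)      ≡⟨ ℤ.⊖-≥ u≤w ⟨
        w ℤ.⊖ u          ≡⟨ ℤ.m-n≡m⊖n w u ⟨
        + w - + u        ≡⟨ cong₂ _-_ +w≡2β² +u≡α² ⟩
        + 2 * (+ β * + β) - + α * + α ∎
        where open ≡-Reasoning

  -- Thue's lemma gives small A, B, not both 0, with p ∣ A² − 2B²; the size bounds then force p = 2B² − A².
  prime∣x²-2y²⇒pm8 : ∀ {p} x y → Prime p → p ≢ 2 → + p ∣ x * x - + 2 * (y * y) → ¬ + p ∣ y
                    → PlusMinusOneMod8ℤ (+ p)
  prime∣x²-2y²⇒pm8 {p} x y p-prime p≢2 p∣x²-2y² p∤y = fromRoot (isqrt p)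
    where
    instance _ = prime⇒nonZero p-prime
    fromRoot : ∃[ m ] (m ℕ.* m ℕ.≤ p × p ℕ.< suc m ℕ.* suc m) → PlusMinusOneMod8ℤ (+ p)
    fromRoot (m , m²≤p , p<[m+1]²) = fromSmallPair (thue p m y x p<[m+1]²)
      where
      fromSmallPair : ∃[ A ] ∃[ B ] (¬ (A ≡ 0ℤ × B ≡ 0ℤ) × ℤ.∣ A ∣ ℕ.≤ m × ℤ.∣ B ∣ ℕ.≤ m × + p ∣ A * y - B * x)
                    → PlusMinusOneMod8ℤ (+ p)
      fromSmallPair (A , B , AB≢0 , ∣A∣≤m , ∣B∣≤m , p∣Ay-Bx) =
        subst PlusMinusOneMod8ℤ (sym p≡2β²-α²) (pm8-twiceSquare-oddSquare (+ α) (+ β) (¬2∣⇒odd (+ α) 2∤α))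
        where
        α β : ℕ
        α = ℤ.∣ A ∣
        β = ℤ.∣ B ∣
        square<p : ∀ {γ} → γ ℕ.≤ m → γ ℕ.* γ ℕ.< p
        square<p γ≤m = ℕ.≤-<-trans (ℕ.*-mono-≤ γ≤m γ≤m) (ℕ.≤∧≢⇒< m²≤p (prime≢square m p-prime))
        p∣A²-2B² : + p ∣ A * A - + 2 * (B * B)
        p∣A²-2B² = prime∣*-cancelˡ y _ p-prime p∤y (prime∣*-cancelˡ y _ p-prime p∤y
          (subst (+ p ∣_) (sym (clear-y A B x y)) (∣m∣n⇒∣m+n (∣m⇒∣m*n (A * y + B * x) p∣Ay-Bx) (∣n⇒∣m*n (B * B) p∣x²-2y²))))
          where
          clear-y : ∀ A B x y → y * (y * (A * A - + 2 * (B * B))) ≡ (A * y - B * x) * (A * y + B * x) + B * B * (x * x - + 2 * (y * y))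
          clear-y = solve-∀
        p≡2β²-α² : + p ≡ + 2 * (+ β * + β) - + α * + α
        p≡2β²-α² = prime-as-norm α β p-prime (square<p ∣A∣≤m) (square<p ∣B∣≤m)
          (λ (α≡0 , β≡0) → AB≢0 (ℤ.∣i∣≡0⇒i≡0 α≡0 , ℤ.∣i∣≡0⇒i≡0 β≡0))
          (subst (+ p ∣_) (cong₂ (λ a b → a - + 2 * b) (square-abs A) (square-abs B)) p∣A²-2B²)
        2∤α : ¬ + 2 ∣ + α
        2∤α (divides γ α≡γ2) = p≢2 (prime-even⇒≡2 p-prime (∣⇒∣ᵤ (divides {+ 2} {+ p} (+ β * + β - + 2 * (γ * γ))
          (trans p≡2β²-α² (trans (cong (λ a → + 2 * (+ β * + β) - a * a) α≡γ2) (factor-two (+ β) γ))))))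
          where
          factor-two : ∀ b γ → + 2 * (b * b) - γ * + 2 * (γ * + 2) ≡ (b * b - + 2 * (γ * γ)) * + 2
          factor-two = solve-∀

module NoIntegralSolutions where
  open Divisibility
  open LocalSolutions using (homogeneousMarkoff; ∣-respʳ)
  open ModEight
  open QuadraticCharacterOfTwo using (prime∣x²-2y²⇒pm8)
  open import Data.Nat.Primality using (Prime; prime[2])
  open import Data.Integer as ℤ using (ℤ; +_; _+_; _*_; _-_; 0ℤ; 1ℤ)
  import Data.Integer.Properties as ℤ
  open import Data.Integer.Divisibility.Signed using (_∣_; _∣?_; divides; ∣-trans; ∣m∣n⇒∣m-n; ∣m⇒∣m*n)
  open import Data.Integer.Tactic.RingSolver using (solve-∀)
  open import Data.Product using (_,_; proj₁; proj₂)
  open import Data.Sum using (inj₁; inj₂; [_,_]′)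
  open import Relation.Nullary using (¬_; yes; no)
  open import Relation.Binary.PropositionalEquality

  homogeneousMarkoff-swap₁₂ : ∀ d b₁ b₂ b₃ → homogeneousMarkoff d b₂ b₁ b₃ ≡ homogeneousMarkoff d b₁ b₂ b₃
  homogeneousMarkoff-swap₁₂ = lemma
    where lemma : ∀ d b₁ b₂ b₃ → d * (b₂ * b₂ + b₁ * b₁ + b₃ * b₃) - b₂ * b₁ * b₃ ≡ d * (b₁ * b₁ + b₂ * b₂ + b₃ * b₃) - b₁ * b₂ * b₃
          lemma = solve-∀

  homogeneousMarkoff-swap₁₃ : ∀ d b₁ b₂ b₃ → homogeneousMarkoff d b₃ b₂ b₁ ≡ homogeneousMarkoff d b₁ b₂ b₃
  homogeneousMarkoff-swap₁₃ = lemma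
    where lemma : ∀ d b₁ b₂ b₃ → d * (b₃ * b₃ + b₂ * b₂ + b₁ * b₁) - b₃ * b₂ * b₁ ≡ d * (b₁ * b₁ + b₂ * b₂ + b₃ * b₃) - b₁ * b₂ * b₃
          lemma = solve-∀

  -- Applied with d = ℓᵉ and w = νd, for which k d³ = 4d³ + 2w²d.
  module _ (d w : ℤ) (d∣w : d ∣ w) (factors-pm8 : ∀ p → Prime p → + p ∣ w → PlusMinusOneMod8ℤ (+ p)) where

    kd³ : ℤ
    kd³ = + 4 * (d * d * d) + + 2 * (w * w) * d

    private
      2∤w : ¬ + 2 ∣ w
      2∤w 2∣w = ¬pm8-2 (factors-pm8 2 prime[2] 2∣w)

      w-odd : Odd w
      w-odd = ¬2∣⇒odd w 2∤w

      d-odd : Odd d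
      d-odd = ¬2∣⇒odd d (λ 2∣d → 2∤w (∣-trans 2∣d d∣w))

    no-integralPoint-allEven : ∀ c₁ c₂ c₃ → homogeneousMarkoff d (+ 2 * c₁) (+ 2 * c₂) (+ 2 * c₃) ≢ kd³
    no-integralPoint-allEven c₁ c₂ c₃ eq with odd-square w-odd | d-odd
    ... | J , w²≡8J+1 | s , d≡2s+1 = even≢odd X (+ 8 * J * s + + 4 * J + s) (trans 2X≡w²d w²d-odd)
      where
      open ≡-Reasoning
      X : ℤ
      X = d * (c₁ * c₁ + c₂ * c₂ + c₃ * c₃) - + 2 * (c₁ * c₂ * c₃) - d * d * d
      2X≡w²d : + 2 * X ≡ w * w * d
      2X≡w²d = ℤ.*-cancelˡ-≡ (+ 2) _ _ (begin
        + 2 * (+ 2 * X)                                                  ≡⟨ expand d c₁ c₂ c₃ ⟩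
        homogeneousMarkoff d (+ 2 * c₁) (+ 2 * c₂) (+ 2 * c₃) - + 4 * (d * d * d) ≡⟨ cong (_- + 4 * (d * d * d)) eq ⟩
        + 4 * (d * d * d) + + 2 * (w * w) * d - + 4 * (d * d * d)        ≡⟨ cancel (d * d * d) w d ⟩
        + 2 * (w * w * d)                                                ∎)
        where
        expand : ∀ d c₁ c₂ c₃ → + 2 * (+ 2 * (d * (c₁ * c₁ + c₂ * c₂ + c₃ * c₃) - + 2 * (c₁ * c₂ * c₃) - d * d * d))
               ≡ d * (+ 2 * c₁ * (+ 2 * c₁) + + 2 * c₂ * (+ 2 * c₂) + + 2 * c₃ * (+ 2 * c₃)) - + 2 * c₁ * (+ 2 * c₂) * (+ 2 * c₃) - + 4 * (d * d * d)
        expand = solve-∀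
        cancel : ∀ e w d → + 4 * e + + 2 * (w * w) * d - + 4 * e ≡ + 2 * (w * w * d)
        cancel = solve-∀
      w²d-odd : w * w * d ≡ + 2 * (+ 8 * J * s + + 4 * J + s) + 1ℤ
      w²d-odd = begin
        w * w * d                          ≡⟨ cong₂ _*_ w²≡8J+1 d≡2s+1 ⟩
        (+ 8 * J + 1ℤ) * (+ 2 * s + 1ℤ)    ≡⟨ expand J s ⟩
        + 2 * (+ 8 * J * s + + 4 * J + s) + 1ℤ ∎
        where
        expand : ∀ J s → (+ 8 * J + 1ℤ) * (+ 2 * s + 1ℤ) ≡ + 2 * (+ 8 * J * s + + 4 * J + s) + 1ℤ
        expand = solve-∀

    no-integralPoint-oddFirst : ∀ b₁ b₂ b₃ → Odd b₁ → homogeneousMarkoff d b₁ b₂ b₃ ≢ kd³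
    no-integralPoint-oddFirst b₁ b₂ b₃ b₁-odd eq = ¬pm8-5 k N≡8k+5 (pm8-of-primeFactors N N≢0 primeFactor-pm8)
      where
      N J₁ J₂ k : ℤ
      N = b₁ * b₁ - + 4 * (d * d)
      J₁ = proj₁ (odd-square b₁-odd)
      J₂ = proj₁ (odd-square d-odd)
      k = J₁ - + 4 * J₂ - 1ℤ
      N≡8k+5 : N ≡ + 8 * k + + 5
      N≡8k+5 = trans (cong₂ (λ a b → a - + 4 * b) (proj₂ (odd-square b₁-odd)) (proj₂ (odd-square d-odd))) (lemma J₁ J₂)
        where lemma : ∀ J₁ J₂ → + 8 * J₁ + 1ℤ - + 4 * (+ 8 * J₂ + 1ℤ) ≡ + 8 * (J₁ - + 4 * J₂ - 1ℤ) + + 5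
              lemma = solve-∀
      2∤N : ¬ + 2 ∣ N
      2∤N (divides t N≡t2) = even≢odd t (+ 4 * k + + 2) (trans (trans (ℤ.*-comm (+ 2) t) (sym N≡t2)) (trans N≡8k+5 (lemma k)))
        where lemma : ∀ k → + 8 * k + + 5 ≡ + 2 * (+ 4 * k + + 2) + 1ℤ
              lemma = solve-∀
      N≢0 : N ≢ 0ℤ
      N≢0 N≡0 = 2∤N (divides 0ℤ N≡0)
      p∣E : ∀ p → + p ∣ homogeneousMarkoff d b₁ b₂ b₃ - kd³
      p∣E p = divides 0ℤ (trans (cong (_- kd³) eq) (ℤ.+-inverseʳ kd³))
      primeFactor-pm8 : ∀ p → Prime p → + p ∣ N → PlusMinusOneMod8ℤ (+ p)
      primeFactor-pm8 p p-prime p∣N with + p ∣? w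
      ... | yes p∣w = factors-pm8 p p-prime p∣w
      ... | no p∤w = [ via (b₂ - b₃) (identity₋ d w b₁ b₂ b₃) , via (b₂ + b₃) (identity₊ d w b₁ b₂ b₃) ]′
                       (prime∣*⇒∣⊎∣ (b₁ - + 2 * d) (b₁ + + 2 * d) p-prime (∣-respʳ (difference-of-squares b₁ d) p∣N))
        where
        p∤d : ¬ + p ∣ d
        p∤d p∣d = p∤w (∣-trans p∣d d∣w)
        p≢2 : p ≢ 2
        p≢2 refl = 2∤N p∣N
        via : ∀ x {f c} → d * (x * x - + 2 * (w * w)) ≡ homogeneousMarkoff d b₁ b₂ b₃ - kd³ - f * c
            → + p ∣ f → PlusMinusOneMod8ℤ (+ p)
        via x {f} {c} identity p∣f = prime∣x²-2y²⇒pm8 x w p-prime p≢2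
          (prime∣*-cancelˡ d _ p-prime p∤d (∣-respʳ (sym identity) (∣m∣n⇒∣m-n (p∣E p) (∣m⇒∣m*n c p∣f)))) p∤w
        difference-of-squares : ∀ b d → b * b - + 4 * (d * d) ≡ (b - + 2 * d) * (b + + 2 * d)
        difference-of-squares = solve-∀
        identity₋ : ∀ d w b₁ b₂ b₃ → d * ((b₂ - b₃) * (b₂ - b₃) - + 2 * (w * w))
          ≡ d * (b₁ * b₁ + b₂ * b₂ + b₃ * b₃) - b₁ * b₂ * b₃ - (+ 4 * (d * d * d) + + 2 * (w * w) * d)
            - (b₁ - + 2 * d) * (+ 2 * (d * d) + d * b₁ - b₂ * b₃)
        identity₋ = solve-∀
        identity₊ : ∀ d w b₁ b₂ b₃ → d * ((b₂ + b₃) * (b₂ + b₃) - + 2 * (w * w))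
          ≡ d * (b₁ * b₁ + b₂ * b₂ + b₃ * b₃) - b₁ * b₂ * b₃ - (+ 4 * (d * d * d) + + 2 * (w * w) * d)
            - (b₁ + + 2 * d) * (d * b₁ - + 2 * (d * d) - b₂ * b₃)
        identity₊ = solve-∀

    no-integralPoint : ∀ b₁ b₂ b₃ → homogeneousMarkoff d b₁ b₂ b₃ ≢ kd³
    no-integralPoint b₁ b₂ b₃ eq with parity b₁ | parity b₂ | parity b₃
    ... | inj₂ b₁-odd | _ | _ = no-integralPoint-oddFirst b₁ b₂ b₃ b₁-odd eq
    ... | inj₁ _ | inj₂ b₂-odd | _ =
      no-integralPoint-oddFirst b₂ b₁ b₃ b₂-odd (trans (homogeneousMarkoff-swap₁₂ d b₁ b₂ b₃) eq)
    ... | inj₁ _ | inj₁ _ | inj₂ b₃-odd =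
      no-integralPoint-oddFirst b₃ b₂ b₁ b₃-odd (trans (homogeneousMarkoff-swap₁₃ d b₁ b₂ b₃) eq)
    ... | inj₁ (c₁ , refl) | inj₁ (c₂ , refl) | inj₁ (c₃ , refl) = no-integralPoint-allEven c₁ c₂ c₃ eq

module IntegerEmbedding where
  open import Defs using (ιℤ)
  open import Data.Integer as ℤ using (ℤ)
  open import Data.Integer.Tactic.RingSolver using (solve-∀)
  open import Data.Rational using (_+_; _*_; _-_; -_; toℚᵘ)
  open import Data.Rational.Properties using (toℚᵘ-injective; toℚᵘ-fromℚᵘ; toℚᵘ-cong; toℚᵘ-homo-+; toℚᵘ-homo-*; toℚᵘ-homo‿-)
  open import Data.Rational.Unnormalised as ℚᵘ using (mkℚᵘ; *≡*) renaming (_≃_ to _≃ᵘ_)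
  import Data.Rational.Unnormalised.Properties as ℚᵘ
  open import Relation.Binary.PropositionalEquality

  private
    toℚᵘ-ιℤ : ∀ a → toℚᵘ (ιℤ a) ≃ᵘ mkℚᵘ a 0
    toℚᵘ-ιℤ a = toℚᵘ-fromℚᵘ (mkℚᵘ a 0)

  ιℤ-+ : ∀ a b → ιℤ (a ℤ.+ b) ≡ ιℤ a + ιℤ b
  ιℤ-+ a b = toℚᵘ-injective (begin
    toℚᵘ (ιℤ (a ℤ.+ b))          ≈⟨ toℚᵘ-ιℤ (a ℤ.+ b) ⟩
    mkℚᵘ (a ℤ.+ b) 0             ≈⟨ *≡* (lemma a b) ⟩
    mkℚᵘ a 0 ℚᵘ.+ mkℚᵘ b 0       ≈⟨ ℚᵘ.+-cong (toℚᵘ-ιℤ a) (toℚᵘ-ιℤ b) ⟨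
    toℚᵘ (ιℤ a) ℚᵘ.+ toℚᵘ (ιℤ b) ≈⟨ toℚᵘ-homo-+ (ιℤ a) (ιℤ b) ⟨
    toℚᵘ (ιℤ a + ιℤ b)           ∎)
    where
    open ℚᵘ.≃-Reasoning
    lemma : ∀ a b → (a ℤ.+ b) ℤ.* ℤ.1ℤ ≡ (a ℤ.* ℤ.1ℤ ℤ.+ b ℤ.* ℤ.1ℤ) ℤ.* ℤ.1ℤ
    lemma = solve-∀

  ιℤ-* : ∀ a b → ιℤ (a ℤ.* b) ≡ ιℤ a * ιℤ b
  ιℤ-* a b = toℚᵘ-injective (begin
    toℚᵘ (ιℤ (a ℤ.* b))          ≈⟨ toℚᵘ-ιℤ (a ℤ.* b) ⟩
    mkℚᵘ (a ℤ.* b) 0             ≈⟨ ℚᵘ.*-cong (toℚᵘ-ιℤ a) (toℚᵘ-ιℤ b) ⟨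
    toℚᵘ (ιℤ a) ℚᵘ.* toℚᵘ (ιℤ b) ≈⟨ toℚᵘ-homo-* (ιℤ a) (ιℤ b) ⟨
    toℚᵘ (ιℤ a * ιℤ b)           ∎)
    where open ℚᵘ.≃-Reasoning

  ιℤ-neg : ∀ a → ιℤ (ℤ.- a) ≡ - ιℤ a
  ιℤ-neg a = toℚᵘ-injective (begin
    toℚᵘ (ιℤ (ℤ.- a))    ≈⟨ toℚᵘ-ιℤ (ℤ.- a) ⟩
    mkℚᵘ (ℤ.- a) 0       ≈⟨ ℚᵘ.-‿cong (toℚᵘ-ιℤ a) ⟨
    ℚᵘ.- toℚᵘ (ιℤ a)     ≈⟨ toℚᵘ-homo‿- (ιℤ a) ⟨
    toℚᵘ (- ιℤ a)        ∎)
    where open ℚᵘ.≃-Reasoning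

  ιℤ-sub : ∀ a b → ιℤ (a ℤ.- b) ≡ ιℤ a - ιℤ b
  ιℤ-sub a b = trans (ιℤ-+ a (ℤ.- b)) (cong (ιℤ a +_) (ιℤ-neg b))

  ιℤ-injective : ∀ {a b} → ιℤ a ≡ ιℤ b → a ≡ b
  ιℤ-injective {a} {b} eq with ℚᵘ.≃-trans (ℚᵘ.≃-sym (toℚᵘ-ιℤ a)) (ℚᵘ.≃-trans (toℚᵘ-cong eq) (toℚᵘ-ιℤ b))
  ... | *≡* a*1≡b*1 = trans (sym (ℤ.*-identityʳ a)) (trans a*1≡b*1 (ℤ.*-identityʳ b))
    where import Data.Integer.Properties as ℤ

module RationalPoints where
  open Divisibility
  open LocalSolutions using (markoffℤ; homogeneousMarkoff; SolvableMod)
  open IntegerEmbedding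
  open import Defs
  open import Data.Nat as ℕ using (ℕ)
  import Data.Nat.Properties as ℕ
  open import Data.Integer as ℤ using (ℤ; +_)
  import Data.Integer.Properties as ℤ
  open import Data.Integer.Divisibility.Signed using (divides)
  open import Data.Rational using (ℚ; _+_; _*_; _-_)
  import Data.Rational.Properties as ℚ
  open import Data.Rational.Solver using (module +-*-Solver)
  open import Data.Nat.Tactic.RingSolver using () renaming (solve-∀ to ℕ-solve-∀)
  open import Data.Product using (∃-syntax; _×_; _,_)
  open import Relation.Binary.PropositionalEquality

  ιℤ-sumOfSquares : ∀ a b c → ιℤ (a ℤ.* a ℤ.+ b ℤ.* b ℤ.+ c ℤ.* c) ≡ ιℤ a * ιℤ a + ιℤ b * ιℤ b + ιℤ c * ιℤ c
  ιℤ-sumOfSquares a b c = trans (ιℤ-+ (a ℤ.* a ℤ.+ b ℤ.* b) (c ℤ.* c))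
    (cong₂ _+_ (trans (ιℤ-+ (a ℤ.* a) (b ℤ.* b)) (cong₂ _+_ (ιℤ-* a a) (ιℤ-* b b))) (ιℤ-* c c))

  ιℤ-product₃ : ∀ a b c → ιℤ (a ℤ.* b ℤ.* c) ≡ ιℤ a * ιℤ b * ιℤ c
  ιℤ-product₃ a b c = trans (ιℤ-* (a ℤ.* b) c) (cong (_* ιℤ c) (ιℤ-* a b))

  ιℤ-markoff : ∀ a b c → ιℤ (markoffℤ a b c) ≡ markoff (ιℤ a) (ιℤ b) (ιℤ c)
  ιℤ-markoff a b c = trans (ιℤ-sub (a ℤ.* a ℤ.+ b ℤ.* b ℤ.+ c ℤ.* c) (a ℤ.* b ℤ.* c))
    (cong₂ _-_ (ιℤ-sumOfSquares a b c) (ιℤ-product₃ a b c))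

  ιℤ-homogeneousMarkoff : ∀ d a b c → ιℤ (homogeneousMarkoff d a b c)
                        ≡ ιℤ d * (ιℤ a * ιℤ a + ιℤ b * ιℤ b + ιℤ c * ιℤ c) - ιℤ a * ιℤ b * ιℤ c
  ιℤ-homogeneousMarkoff d a b c = trans (ιℤ-sub (d ℤ.* (a ℤ.* a ℤ.+ b ℤ.* b ℤ.+ c ℤ.* c)) (a ℤ.* b ℤ.* c))
    (cong₂ _-_ (trans (ιℤ-* d _) (cong (ιℤ d *_) (ιℤ-sumOfSquares a b c))) (ιℤ-product₃ a b c))

  integral∈ℤ[1/ℓ] : ∀ ℓ a → InZ[1/ ℓ ] (ιℤ a)
  integral∈ℤ[1/ℓ] ℓ a = 0 , a , ℚ.*-identityˡ (ιℤ a)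

  solvableMod⇒congruence : ∀ ℓ q k → SolvableMod (+ k) q → ∃[ x₁ ] ∃[ x₂ ] ∃[ x₃ ]
    (InZ[1/ ℓ ] x₁ × InZ[1/ ℓ ] x₂ × InZ[1/ ℓ ] x₃ × CongMod ℓ q (markoff x₁ x₂ x₃) (ιℕ k))
  solvableMod⇒congruence ℓ q k (a₁ , a₂ , a₃ , divides t eq) =
    ιℤ a₁ , ιℤ a₂ , ιℤ a₃ , integral∈ℤ[1/ℓ] ℓ a₁ , integral∈ℤ[1/ℓ] ℓ a₂ , integral∈ℤ[1/ℓ] ℓ a₃ ,
    ιℤ t , integral∈ℤ[1/ℓ] ℓ t , (begin
      markoff (ιℤ a₁) (ιℤ a₂) (ιℤ a₃) - ιℕ k  ≡⟨ cong (_- ιℕ k) (ιℤ-markoff a₁ a₂ a₃) ⟨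
      ιℤ (markoffℤ a₁ a₂ a₃) - ιℤ (+ k)       ≡⟨ ιℤ-sub (markoffℤ a₁ a₂ a₃) (+ k) ⟨
      ιℤ (markoffℤ a₁ a₂ a₃ ℤ.- + k)          ≡⟨ cong ιℤ eq ⟩
      ιℤ (t ℤ.* + q)                          ≡⟨ ιℤ-* t (+ q) ⟩
      ιℤ t * ιℕ q                             ≡⟨ ℚ.*-comm (ιℤ t) (ιℕ q) ⟩
      ιℕ q * ιℤ t                             ∎)
    where open ≡-Reasoning

  module _ (ℓ : ℕ) where

    ℤ[1/ℓ]-raise : ∀ f {e x a} → ιℕ (ℓ ℕ.^ e) * x ≡ ιℤ a → ιℕ (ℓ ℕ.^ (f ℕ.+ e)) * x ≡ ιℤ (+ (ℓ ℕ.^ f) ℤ.* a)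
    ℤ[1/ℓ]-raise f {e} {x} {a} ℓᵉx≡a = begin
      ιℕ (ℓ ℕ.^ (f ℕ.+ e)) * x                  ≡⟨ cong (λ n → ιℕ n * x) (ℕ.^-distribˡ-+-* ℓ f e) ⟩
      ιℤ (+ (ℓ ℕ.^ f ℕ.* ℓ ℕ.^ e)) * x          ≡⟨ cong (λ z → ιℤ z * x) (ℤ.pos-* (ℓ ℕ.^ f) (ℓ ℕ.^ e)) ⟩
      ιℤ (+ (ℓ ℕ.^ f) ℤ.* + (ℓ ℕ.^ e)) * x      ≡⟨ cong (_* x) (ιℤ-* (+ (ℓ ℕ.^ f)) (+ (ℓ ℕ.^ e))) ⟩
      ιℕ (ℓ ℕ.^ f) * ιℕ (ℓ ℕ.^ e) * x           ≡⟨ ℚ.*-assoc (ιℕ (ℓ ℕ.^ f)) (ιℕ (ℓ ℕ.^ e)) x ⟩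
      ιℕ (ℓ ℕ.^ f) * (ιℕ (ℓ ℕ.^ e) * x)         ≡⟨ cong (ιℕ (ℓ ℕ.^ f) *_) ℓᵉx≡a ⟩
      ιℕ (ℓ ℕ.^ f) * ιℤ a                       ≡⟨ ιℤ-* (+ (ℓ ℕ.^ f)) a ⟨
      ιℤ (+ (ℓ ℕ.^ f) ℤ.* a)                    ∎
      where open ≡-Reasoning

    commonDenominator : ∀ {x₁ x₂ x₃} → InZ[1/ ℓ ] x₁ → InZ[1/ ℓ ] x₂ → InZ[1/ ℓ ] x₃
      → ∃[ e ] ∃[ b₁ ] ∃[ b₂ ] ∃[ b₃ ] (ιℕ (ℓ ℕ.^ e) * x₁ ≡ ιℤ b₁ × ιℕ (ℓ ℕ.^ e) * x₂ ≡ ιℤ b₂ × ιℕ (ℓ ℕ.^ e) * x₃ ≡ ιℤ b₃)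
    commonDenominator {x₁} {x₂} {x₃} (e₁ , a₁ , h₁) (e₂ , a₂ , h₂) (e₃ , a₃ , h₃) =
      e₁ ℕ.+ e₂ ℕ.+ e₃ , scaled (e₂ ℕ.+ e₃) a₁ , scaled (e₁ ℕ.+ e₃) a₂ , scaled (e₁ ℕ.+ e₂) a₃ ,
      subst (λ e → ιℕ (ℓ ℕ.^ e) * x₁ ≡ ιℤ (scaled (e₂ ℕ.+ e₃) a₁)) (exponent₁ e₁ e₂ e₃) (ℤ[1/ℓ]-raise (e₂ ℕ.+ e₃) h₁) ,
      subst (λ e → ιℕ (ℓ ℕ.^ e) * x₂ ≡ ιℤ (scaled (e₁ ℕ.+ e₃) a₂)) (exponent₂ e₁ e₂ e₃) (ℤ[1/ℓ]-raise (e₁ ℕ.+ e₃) h₂) ,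
      ℤ[1/ℓ]-raise (e₁ ℕ.+ e₂) h₃
      where
      scaled : ℕ → ℤ → ℤ
      scaled f a = + (ℓ ℕ.^ f) ℤ.* a
      exponent₁ : ∀ e₁ e₂ e₃ → e₂ ℕ.+ e₃ ℕ.+ e₁ ≡ e₁ ℕ.+ e₂ ℕ.+ e₃
      exponent₁ = ℕ-solve-∀
      exponent₂ : ∀ e₁ e₂ e₃ → e₁ ℕ.+ e₃ ℕ.+ e₂ ≡ e₁ ℕ.+ e₂ ℕ.+ e₃
      exponent₂ = ℕ-solve-∀

  homogenise : ∀ d k b₁ b₂ b₃ {x₁ x₂ x₃} → ιℤ d * x₁ ≡ ιℤ b₁ → ιℤ d * x₂ ≡ ιℤ b₂ → ιℤ d * x₃ ≡ ιℤ b₃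
             → markoff x₁ x₂ x₃ ≡ ιℤ k → homogeneousMarkoff d b₁ b₂ b₃ ≡ k ℤ.* (d ℤ.* d ℤ.* d)
  homogenise d k b₁ b₂ b₃ {x₁} {x₂} {x₃} h₁ h₂ h₃ on-surface = ιℤ-injective (begin
    ιℤ (homogeneousMarkoff d b₁ b₂ b₃)                    ≡⟨ ιℤ-homogeneousMarkoff d b₁ b₂ b₃ ⟩
    form (ιℤ b₁) (ιℤ b₂) (ιℤ b₃)                          ≡⟨ cong₃ form h₁ h₂ h₃ ⟨
    form (ιℤ d * x₁) (ιℤ d * x₂) (ιℤ d * x₃)              ≡⟨ scale (ιℤ d) x₁ x₂ x₃ ⟩
    ιℤ d * ιℤ d * ιℤ d * markoff x₁ x₂ x₃                 ≡⟨ cong (ιℤ d * ιℤ d * ιℤ d *_) on-surface ⟩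
    ιℤ d * ιℤ d * ιℤ d * ιℤ k                             ≡⟨ cong (_* ιℤ k) (ιℤ-product₃ d d d) ⟨
    ιℤ (d ℤ.* d ℤ.* d) * ιℤ k                             ≡⟨ ℚ.*-comm _ (ιℤ k) ⟩
    ιℤ k * ιℤ (d ℤ.* d ℤ.* d)                             ≡⟨ ιℤ-* k (d ℤ.* d ℤ.* d) ⟨
    ιℤ (k ℤ.* (d ℤ.* d ℤ.* d))                            ∎)
    where
    open ≡-Reasoning
    form : ℚ → ℚ → ℚ → ℚ
    form y₁ y₂ y₃ = ιℤ d * (y₁ * y₁ + y₂ * y₂ + y₃ * y₃) - y₁ * y₂ * y₃
    cong₃ : ∀ (f : ℚ → ℚ → ℚ → ℚ) {a b c a′ b′ c′} → a ≡ a′ → b ≡ b′ → c ≡ c′ → f a b c ≡ f a′ b′ c′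
    cong₃ f refl refl refl = refl
    scale : ∀ D x₁ x₂ x₃ → D * ((D * x₁) * (D * x₁) + (D * x₂) * (D * x₂) + (D * x₃) * (D * x₃)) - (D * x₁) * (D * x₂) * (D * x₃)
                         ≡ D * D * D * (x₁ * x₁ + x₂ * x₂ + x₃ * x₃ - x₁ * x₂ * x₃)
    scale = solve 4 (λ D x₁ x₂ x₃ → D :* ((D :* x₁) :* (D :* x₁) :+ (D :* x₂) :* (D :* x₂) :+ (D :* x₃) :* (D :* x₃))
                                    :- (D :* x₁) :* (D :* x₂) :* (D :* x₃)
                                  := D :* D :* D :* (x₁ :* x₁ :+ x₂ :* x₂ :+ x₃ :* x₃ :- x₁ :* x₂ :* x₃)) refl
      where open +-*-Solver

open import Defs
open import Data.Nat using (ℕ; zero; suc; _+_; _*_; _^_; _%_; _≥_; >-nonZero)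
open import Data.Nat.Divisibility using (_∣_; ∣1⇒≡1)
open import Data.Nat.Primality using (Prime; euclidsLemma; prime⇒irreducible; ¬prime[1])
open import Data.Integer as ℤ using (+_)
import Data.Integer.Properties as ℤ
import Data.Integer.Divisibility.Signed as ℤ
open import Data.Integer.Tactic.RingSolver using (solve-∀)
import Data.Rational as ℚ
open import Data.Product using (_×_; ∃-syntax; _,_)
open import Data.Sum using (_⊎_; [_,_]′)
open import Data.Empty using (⊥; ⊥-elim)
open import Function using (_∘_; id)
open import Relation.Nullary using (¬_)
open import Relation.Binary.PropositionalEquality
open LocalSolutions using (SolvableMod; homogeneousMarkoff; markoffConstant; markoffConstant-pos; localSolvability)
open ModEight using (PlusMinusOneMod8ℤ; pm8-fromℕ)
open NoIntegralSolutions using (no-integralPoint)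
open RationalPoints using (solvableMod⇒congruence; commonDenominator; homogenise)

prime∣^⇒∣ : ∀ {p m} n → Prime p → p ∣ m ^ n → p ∣ m
prime∣^⇒∣ zero p-prime p∣1 with ∣1⇒≡1 p∣1
... | refl = ⊥-elim (¬prime[1] p-prime)
prime∣^⇒∣ {m = m} (suc n) p-prime p∣mᵐ⁺¹ = [ id , prime∣^⇒∣ n p-prime ]′ (euclidsLemma m (m ^ n) p-prime p∣mᵐ⁺¹)

prime∣prime⇒≡ : ∀ {p q} → Prime p → Prime q → p ∣ q → p ≡ q
prime∣prime⇒≡ p-prime q-prime p∣q = [ (λ { refl → ⊥-elim (¬prime[1] p-prime) }) , id ]′ (prime⇒irreducible q-prime p∣q)

primeFactors-pm8 : ∀ {ℓ ν} e → Prime ℓ → PlusMinusOneMod8 ℓ → (∀ p → Prime p → p ∣ ν → PlusMinusOneMod8 p)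
                 → ∀ p → Prime p → p ∣ ν * ℓ ^ e → PlusMinusOneMod8 p
primeFactors-pm8 {ℓ} {ν} e ℓ-prime ℓ-pm8 ν-factors p p-prime p∣νℓᵉ =
  [ ν-factors p p-prime
  , (λ p∣ℓᵉ → subst PlusMinusOneMod8 (sym (prime∣prime⇒≡ p-prime ℓ-prime (prime∣^⇒∣ e p-prime p∣ℓᵉ))) ℓ-pm8)
  ]′ (euclidsLemma ν (ℓ ^ e) p-prime p∣νℓᵉ)

no-ℤ[1/ℓ]-point : ∀ ℓ ν → Prime ℓ → PlusMinusOneMod8 ℓ → (∀ p → Prime p → p ∣ ν → PlusMinusOneMod8 p)
  → ¬ (∃[ x₁ ] ∃[ x₂ ] ∃[ x₃ ] (InZ[1/ ℓ ] x₁ × InZ[1/ ℓ ] x₂ × InZ[1/ ℓ ] x₃ × markoff x₁ x₂ x₃ ≡ ιℕ (4 + 2 * (ν * ν))))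
no-ℤ[1/ℓ]-point ℓ ν ℓ-prime ℓ-pm8 ν-factors (x₁ , x₂ , x₃ , z₁ , z₂ , z₃ , on-surface) =
  clear (commonDenominator ℓ z₁ z₂ z₃)
  where
  clear : ∃[ e ] ∃[ b₁ ] ∃[ b₂ ] ∃[ b₃ ]
            (ιℕ (ℓ ^ e) ℚ.* x₁ ≡ ιℤ b₁ × ιℕ (ℓ ^ e) ℚ.* x₂ ≡ ιℤ b₂ × ιℕ (ℓ ^ e) ℚ.* x₃ ≡ ιℤ b₃) → ⊥
  clear (e , b₁ , b₂ , b₃ , h₁ , h₂ , h₃) =
    no-integralPoint d (+ ν ℤ.* d) (ℤ.divides (+ ν) refl) factors-pm8 b₁ b₂ b₃ (begin
      homogeneousMarkoff d b₁ b₂ b₃             ≡⟨ homogenise d (+ (4 + 2 * (ν * ν))) b₁ b₂ b₃ h₁ h₂ h₃ on-surface ⟩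
      + (4 + 2 * (ν * ν)) ℤ.* (d ℤ.* d ℤ.* d)   ≡⟨ cong (ℤ._* (d ℤ.* d ℤ.* d)) (markoffConstant-pos ν) ⟩
      markoffConstant (+ ν) ℤ.* (d ℤ.* d ℤ.* d) ≡⟨ expand (+ ν) d ⟩
      + 4 ℤ.* (d ℤ.* d ℤ.* d) ℤ.+ + 2 ℤ.* (+ ν ℤ.* d ℤ.* (+ ν ℤ.* d)) ℤ.* d ∎)
    where
    open ≡-Reasoning
    d : ℤ.ℤ
    d = + (ℓ ^ e)
    expand : ∀ n d → (+ 4 ℤ.+ + 2 ℤ.* (n ℤ.* n)) ℤ.* (d ℤ.* d ℤ.* d)
                   ≡ + 4 ℤ.* (d ℤ.* d ℤ.* d) ℤ.+ + 2 ℤ.* (n ℤ.* d ℤ.* (n ℤ.* d)) ℤ.* d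
    expand = solve-∀
    factors-pm8 : ∀ p → Prime p → + p ℤ.∣ + ν ℤ.* d → PlusMinusOneMod8ℤ (+ p)
    factors-pm8 p p-prime p∣νd = pm8-fromℕ p (primeFactors-pm8 e ℓ-prime ℓ-pm8 ν-factors p p-prime
      (subst (p ∣_) (ℤ.abs-* (+ ν) d) (ℤ.∣⇒∣ᵤ p∣νd)))

proposition5p6 : (ℓ ν : ℕ) → Prime ℓ → PlusMinusOneMod8 ℓ → ν ≥ 1
    → (∀ p → Prime p → p ∣ ν → PlusMinusOneMod8 p)
    → (ν % 9 ≡ 0 ⊎ ν % 9 ≡ 3 ⊎ ν % 9 ≡ 6 ⊎ ν % 9 ≡ 4 ⊎ ν % 9 ≡ 5)
    → let k = 4 + 2 * (ν * ν) in
      ((q : ℕ) → q ≥ 1 → ∃[ x₁ ] ∃[ x₂ ] ∃[ x₃ ]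
          (InZ[1/ ℓ ] x₁ × InZ[1/ ℓ ] x₂ × InZ[1/ ℓ ] x₃
            × CongMod ℓ q (markoff x₁ x₂ x₃) (ιℕ k)))
      × ¬ (∃[ x₁ ] ∃[ x₂ ] ∃[ x₃ ]
          (InZ[1/ ℓ ] x₁ × InZ[1/ ℓ ] x₂ × InZ[1/ ℓ ] x₃
            × markoff x₁ x₂ x₃ ≡ ιℕ k))
proposition5p6 ℓ ν ℓ-prime ℓ-pm8 _ ν-factors ν-mod9 =
  (λ q q≥1 → solvableMod⇒congruence ℓ q (4 + 2 * (ν * ν))
               (subst (λ k → SolvableMod k q) (sym (markoffConstant-pos ν)) (localSolvability ν ν-mod9 q {{>-nonZero q≥1}})))
  , no-ℤ[1/ℓ]-point ℓ ν ℓ-prime ℓ-pm8 ν-factors
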